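{- Let $n,k$ be positive integers and let $\sigma\in\mathfrak{S}_n$ have cycle type $(c_1,\dots,c_n)$, where $c_\ell$ is the number of cycles of length $\ell$ in $\sigma$. Then the number of fixed points of $\sigma^{\odot k}$ is $$\operatorname{Fix}(\sigma^{\odot k})=\sum_{s_1+2s_2+\cdots+ns_n=k}\ \prod_{\ell=1}^n\binom{s_\ell+c_\ell-1}{s_\ell},$$ where the sum runs over all sequences $(s_1,\dots,s_n)$ of non-negative integers with $s_1+2s_2+\cdots+ns_n=k$.
   Context: For positive integers $n,k$, let $\mathcal{C}_{n,k}$ be the set of weakly increasing $k$-tuples $(i_1\le\cdots\le i_k)$ with entries in $[n]$ (equivalently, $k$-element multisets from $[n]$). For $\sigma\in\mathfrak{S}_n$, the $k$-th symmetric tensor power $\sigma^{\odot k}$ is the permutation of $\mathcal{C}_{n,k}$ sending $(i_1,\dots,i_k)$ to the weakly increasing rearrangement of $(\sigma(i_1),\dots,\sigma(i_k))$ (equivalently, the permutation given by the $k$-th symmetric tensor power of the permutation matrix of $\sigma$). $\operatorname{Fix}(\tau)$ is the number of fixed points of $\tau$. Binomial coefficients $\binom{a}{b}$ with integer $a$ and nonnegative integer $b$ are $a(a-1)\cdots(a-b+1)/b!$ (so $\binom{ -1}{0}=1$ and $\binom{m-1}{m}=0$ for $m\ge1$). -}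

module Defs where

open import Data.Bool using (Bool; true; false; _∧_; if_then_else_)
open import Data.Nat using (ℕ; zero; suc; _+_; _*_; _∸_; _≤ᵇ_; _≡ᵇ_)
open import Data.Nat.Combinatorics using (_C_)
open import Data.Fin using (Fin; toℕ) renaming (_≟_ to _≟ᶠ_)
open import Data.Fin.Permutation using (Permutation′; _⟨$⟩ʳ_)
open import Data.List using (List; []; _∷_; length; filter; map; concatMap; allFin; upTo; foldr)
open import Data.Nat.ListAction using (sum)
open import Data.Vec using (Vec; []; _∷_)
import Data.Vec as Vec
open import Data.Vec.Properties using (≡-dec)
open import Relation.Binary.PropositionalEquality using (_≡_)
open import Relation.Nullary.Decidable using (⌊_⌋)
open import Relation.Unary using (Pred)
open import Data.Bool using (T)
open import Relation.Nullary.Decidable using (T?)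

allVecs : {A : Set} → List A → (k : ℕ) → List (Vec A k)
allVecs xs zero    = [] ∷ []
allVecs xs (suc k) = concatMap (λ x → map (x ∷_) (allVecs xs k)) xs

count : {A : Set} → (A → Bool) → List A → ℕ
count p xs = length (filter (λ x → T? (p x)) xs)

_≤ᶠ_ : {n : ℕ} → Fin n → Fin n → Bool
i ≤ᶠ j = toℕ i ≤ᵇ toℕ j

weaklyIncreasing : {n k : ℕ} → Vec (Fin n) k → Bool
weaklyIncreasing []           = true
weaklyIncreasing (x ∷ [])     = true
weaklyIncreasing (x ∷ y ∷ xs) = (x ≤ᶠ y) ∧ weaklyIncreasing (y ∷ xs)

𝒞 : (n k : ℕ) → List (Vec (Fin n) k)
𝒞 n k = filter (λ t → T? (weaklyIncreasing t)) (allVecs (allFin n) k)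

insert : {n k : ℕ} → Fin n → Vec (Fin n) k → Vec (Fin n) (suc k)
insert x []       = x ∷ []
insert x (y ∷ ys) = if x ≤ᶠ y then x ∷ y ∷ ys else y ∷ insert x ys

sortV : {n k : ℕ} → Vec (Fin n) k → Vec (Fin n) k
sortV []       = []
sortV (x ∷ xs) = insert x (sortV xs)

symPow : {n : ℕ} → Permutation′ n → (k : ℕ) → Vec (Fin n) k → Vec (Fin n) k
symPow σ k t = sortV (Vec.map (σ ⟨$⟩ʳ_) t)

Fix-symPow : {n : ℕ} → Permutation′ n → (k : ℕ) → ℕ
Fix-symPow {n} σ k = count (λ t → ⌊ ≡-dec _≟ᶠ_ (symPow σ k t) t ⌋) (𝒞 n k)

iter : {n : ℕ} → Permutation′ n → ℕ → Fin n → Fin n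
iter σ zero    i = i
iter σ (suc m) i = σ ⟨$⟩ʳ (iter σ m i)

-- least m in {1,…,bound} with σ^m(i) = i (0 if none; for bound = n one always exists)
firstReturn : {n : ℕ} → Permutation′ n → Fin n → ℕ → ℕ → ℕ
firstReturn σ i m zero      = zero
firstReturn σ i m (suc fuel) =
  if ⌊ iter σ m i ≟ᶠ i ⌋ then m else firstReturn σ i (suc m) fuel

cycleLen : {n : ℕ} → Permutation′ n → Fin n → ℕ
cycleLen {n} σ i = firstReturn σ i 1 n

allBelow : ℕ → (ℕ → Bool) → Bool
allBelow zero    p = true
allBelow (suc m) p = p m ∧ allBelow m p

isCycleMin : {n : ℕ} → Permutation′ n → Fin n → Bool
isCycleMin σ i = allBelow (cycleLen σ i) (λ j → i ≤ᶠ iter σ j i)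

-- c_ℓ(σ) = number of cycles of length ℓ in σ
-- (each cycle is counted once, via its smallest element)
cycleType : {n : ℕ} → Permutation′ n → ℕ → ℕ
cycleType {n} σ ℓ = count (λ i → (cycleLen σ i ≡ᵇ ℓ) ∧ isCycleMin σ i) (allFin n)

-- binom (s + c - 1) s with the integer-upper-index convention of the paper:
-- for s = 0 it is 1 (including c = 0, i.e. binom(-1,0) = 1); for s ≥ 1 the
-- upper index s + c - 1 ≥ 0, so it is the ordinary binomial coefficient
-- (which is 0 when c = 0, i.e. binom(s-1, s) = 0).
binomSC : ℕ → ℕ → ℕ
binomSC zero    c = 1
binomSC (suc s) c = (suc s + c ∸ 1) C (suc s)

-- for s : Vec ℕ n, the entry at index i corresponds to s_ℓ with ℓ = i+1
weightedSum : {n : ℕ} → Vec ℕ n → ℕ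
weightedSum {n} s = sum (map (λ i → suc (toℕ i) * Vec.lookup s i) (allFin n))

prodBinom : {n : ℕ} → (ℕ → ℕ) → Vec ℕ n → ℕ
prodBinom {n} c s =
  foldr _*_ 1 (map (λ i → binomSC (Vec.lookup s i) (c (suc (toℕ i)))) (allFin n))

-- all (s₁,…,s_n) ∈ ℕⁿ with s₁ + 2 s₂ + … + n s_n = k
-- (every such sequence has all s_ℓ ≤ k, so enumerating entries in {0,…,k} is exhaustive)
solutions : (n k : ℕ) → List (Vec ℕ n)
solutions n k = filter (λ s → T? (weightedSum s ≡ᵇ k)) (allVecs (upTo (suc k)) n)

rhs : (n k : ℕ) → (ℕ → ℕ) → ℕ
rhs n k c = sum (map (prodBinom c) (solutions n k))

{-# OPTIONS --safe #-}
module Submission where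

-- A weakly increasing k-tuple is a multiset on [n], i.e. a multiplicity vector m with
-- total k, and it is fixed by σ^{⊙k} exactly when m is constant on the cycles of σ.
-- Such m correspond to weights h on the cycles (stored at the cycle minima) with
-- ∑ (cycle length)·h = k, so Fix(σ^{⊙k}) is the coefficient of t^k in
-- ∏_{cycles} 1/(1 - t^{length}) = ∏_ℓ (1 - t^ℓ)^{-c_ℓ}, and expanding each factor as
-- ∑_s binom(s + c_ℓ - 1, s) t^{ℓ s} gives the right-hand side. Series are represented by
-- their coefficients; (1 - t^ℓ)^{-c-1} arises from (1 - t^ℓ)^{-c} by taking partial sums of
-- coefficients, which is Pascal's rule.

open import Data.Bool using (Bool; true; false; T; _∧_; _∨_)
open import Data.Bool.Properties using (∧-zeroʳ; ∧-identityʳ; T-∧)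
open import Data.Fin using (Fin; zero; suc; toℕ; fromℕ<) renaming (_≟_ to _≟ᶠ_)
open import Data.Fin.Permutation using (Permutation′; _⟨$⟩ʳ_; _⟨$⟩ˡ_; inverseʳ; inverseˡ)
open import Data.Fin.Properties using (toℕ<n; toℕ-fromℕ<; toℕ-injective; pigeonhole; all?)
open import Data.List using (List; []; _∷_; _++_; map; filter; concatMap; length; allFin; upTo; applyUpTo; tabulate; foldr)
open import Data.List.Properties using (length-upTo)
open import Data.List.Relation.Unary.All.Properties using (applyUpTo⁺₂; applyUpTo⁻)
open import Data.Nat
open import Data.Nat.Combinatorics using (_C_; k>n⇒nCk≡0; nCk+nC[k+1]≡[n+1]C[k+1])
open import Data.Nat.DivMod using (_%_; _/_; m≡m%n+[m/n]*n; m%n<n)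
open import Data.Nat.Induction using (<-rec)
open import Data.Nat.ListAction using (sum)
open import Data.Nat.Properties
open import Data.Nat.Tactic.RingSolver using (solve-∀)
open import Data.Product using (_×_; _,_; proj₁; proj₂; ∃-syntax)
open import Data.Sum using (_⊎_; inj₁; inj₂)
import Data.Vec as Vec
open import Data.Vec using (Vec; []; _∷_; lookup)
open import Data.Vec.Functional as Vector using (Vector; updateAt)
open import Data.Vec.Functional.Properties using (updateAt-updates; updateAt-minimal)
open import Data.Vec.Properties using (≡-dec; lookup∘tabulate; tabulate∘lookup; tabulate-cong)
open import Function using (_∘_; _$_; id; _⇔_; mk⇔; Equivalence)
open import Relation.Binary.Definitions using (DecidableEquality; tri<; tri≈; tri>)
open import Relation.Binary.PropositionalEquality
open import Relation.Nullary using (Dec; yes; no; does; ¬_; contradiction; _×-dec_; _⊎-dec_)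
open import Relation.Nullary.Decidable using (T?; isYes; isYes≗does)
open import Algebra.Properties.CommutativeSemigroup +-commutativeSemigroup using (interchange)
open import Algebra.Properties.Semiring.Sum +-*-semiring
  using (sum-syntax; ∑-comm; ∑-distrib-+; *-distribˡ-sum; sum-cong-≗; sum-replicate-zero)
open import Data.List.Extrema ≤-totalOrder using (argmin; argmin-all; f[argmin]≤f[xs])

open import Defs

𝟙 : Bool → ℕ
𝟙 true  = 1
𝟙 false = 0

𝟙-∧ : ∀ a b → 𝟙 (a ∧ b) ≡ 𝟙 a * 𝟙 b
𝟙-∧ true  b = sym (*-identityˡ (𝟙 b))
𝟙-∧ false b = refl

𝟙≤1 : ∀ b → 𝟙 b ≤ 1
𝟙≤1 true  = ≤-refl
𝟙≤1 false = z≤n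

module _ {P : Set} where

  𝟙-yes : (P? : Dec P) → P → 𝟙 (does P?) ≡ 1
  𝟙-yes (yes _) _ = refl
  𝟙-yes (no ¬p) p = contradiction p ¬p

  𝟙-no : (P? : Dec P) → ¬ P → 𝟙 (does P?) ≡ 0
  𝟙-no (yes p) ¬p = contradiction p ¬p
  𝟙-no (no _)  _  = refl

  𝟙-*-yes : (P? : Dec P) → P → ∀ x → 𝟙 (does P?) * x ≡ x
  𝟙-*-yes P? p x = trans (cong (_* x) (𝟙-yes P? p)) (*-identityˡ x)

  𝟙-*-no : (P? : Dec P) → ¬ P → ∀ x → 𝟙 (does P?) * x ≡ 0
  𝟙-*-no P? ¬p x = cong (_* x) (𝟙-no P? ¬p)

  𝟙-*-cong : (P? : Dec P) {x y : ℕ} → (P → x ≡ y) → 𝟙 (does P?) * x ≡ 𝟙 (does P?) * y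
  𝟙-*-cong (yes p) x≡y = cong (1 *_) (x≡y p)
  𝟙-*-cong (no _)  _   = refl

  𝟙-⇔ : {Q : Set} (P? : Dec P) (Q? : Dec Q) → P ⇔ Q → 𝟙 (does P?) ≡ 𝟙 (does Q?)
  𝟙-⇔ P? (yes q) P⇔Q = 𝟙-yes P? (Equivalence.from P⇔Q q)
  𝟙-⇔ P? (no ¬q) P⇔Q = 𝟙-no P? (¬q ∘ Equivalence.to P⇔Q)

𝟙-×-⇔ : {P Q R S : Set} (P? : Dec P) (Q? : Dec Q) (R? : Dec R) (S? : Dec S) → (P × Q) ⇔ (R × S) →
  𝟙 (does P?) * 𝟙 (does Q?) ≡ 𝟙 (does R?) * 𝟙 (does S?)
𝟙-×-⇔ P? Q? R? S? eq =
  trans (sym (𝟙-∧ (does P?) (does Q?))) (trans (𝟙-⇔ (P? ×-dec Q?) (R? ×-dec S?) eq) (𝟙-∧ (does R?) (does S?)))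

𝟙-+≤ᵇ : ∀ a b k → 𝟙 (a + b ≤ᵇ k) ≡ 𝟙 (a ≤ᵇ k) * 𝟙 (b ≤ᵇ k ∸ a)
𝟙-+≤ᵇ a b k with a ≤? k
... | yes a≤k = trans (𝟙-⇔ (a + b ≤? k) (b ≤? k ∸ a) $ mk⇔
                  (λ p → subst (_≤ k ∸ a) (m+n∸m≡n a b) (∸-monoˡ-≤ a p))
                  (λ p → subst (a + b ≤_) (m+[n∸m]≡n a≤k) (+-monoʳ-≤ a p)))
                (sym (𝟙-*-yes (a ≤? k) a≤k (𝟙 (b ≤ᵇ k ∸ a))))
... | no a≰k  = trans (𝟙-no (a + b ≤? k) (a≰k ∘ ≤-trans (m≤m+n a b)))
                (sym (𝟙-*-no (a ≤? k) a≰k (𝟙 (b ≤ᵇ k ∸ a))))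

𝟙-+≡ᵇ : ∀ a b k → 𝟙 (a + b ≡ᵇ k) ≡ 𝟙 (a ≤ᵇ k) * 𝟙 (b ≡ᵇ k ∸ a)
𝟙-+≡ᵇ a b k with a ≤? k
... | yes a≤k = trans (𝟙-⇔ (a + b ≟ k) (b ≟ k ∸ a) $ mk⇔
                  (λ p → trans (sym (m+n∸m≡n a b)) (cong (_∸ a) p))
                  (λ p → trans (cong (a +_) p) (m+[n∸m]≡n a≤k)))
                (sym (𝟙-*-yes (a ≤? k) a≤k (𝟙 (b ≡ᵇ k ∸ a))))
... | no a≰k  = trans (𝟙-no (a + b ≟ k) (λ p → a≰k (subst (a ≤_) p (m≤m+n a b))))
                (sym (𝟙-*-no (a ≤? k) a≰k (𝟙 (b ≡ᵇ k ∸ a))))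

𝟙-*≤ᵇ-beyond : ∀ {ℓ} → 0 < ℓ → ∀ {k x} → k < x → 𝟙 (ℓ * x ≤ᵇ k) ≡ 0
𝟙-*≤ᵇ-beyond {ℓ} 0<ℓ {k} {x} k<x =
  𝟙-no (ℓ * x ≤? k) (λ p → <⇒≱ k<x (≤-trans (m≤n*m x ℓ {{>-nonZero 0<ℓ}}) p))

-- Finite sums

∑ˡ : {A : Set} → List A → (A → ℕ) → ℕ
∑ˡ xs f = sum (map f xs)

syntax ∑ˡ xs (λ x → e) = ∑[ x ∈ xs ] e

module _ {A : Set} where

  ∑ˡ-cong : (xs : List A) {f g : A → ℕ} → (∀ x → f x ≡ g x) → ∑ˡ xs f ≡ ∑ˡ xs g
  ∑ˡ-cong []       _ = refl
  ∑ˡ-cong (x ∷ xs) e = cong₂ _+_ (e x) (∑ˡ-cong xs e)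

  ∑ˡ-zero : (xs : List A) {f : A → ℕ} → (∀ x → f x ≡ 0) → ∑ˡ xs f ≡ 0
  ∑ˡ-zero []       _ = refl
  ∑ˡ-zero (x ∷ xs) e = cong₂ _+_ (e x) (∑ˡ-zero xs e)

  ∑ˡ-distrib-+ : (xs : List A) (f g : A → ℕ) → ∑[ x ∈ xs ] (f x + g x) ≡ ∑ˡ xs f + ∑ˡ xs g
  ∑ˡ-distrib-+ []       f g = refl
  ∑ˡ-distrib-+ (x ∷ xs) f g = begin
    f x + g x + ∑[ y ∈ xs ] (f y + g y) ≡⟨ cong (f x + g x +_) (∑ˡ-distrib-+ xs f g) ⟩
    f x + g x + (∑ˡ xs f + ∑ˡ xs g)     ≡⟨ interchange (f x) (g x) (∑ˡ xs f) (∑ˡ xs g) ⟩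
    f x + ∑ˡ xs f + (g x + ∑ˡ xs g)     ∎
    where open ≡-Reasoning

  *-distribˡ-∑ˡ : (c : ℕ) (xs : List A) (f : A → ℕ) → c * ∑ˡ xs f ≡ ∑[ x ∈ xs ] (c * f x)
  *-distribˡ-∑ˡ c []       f = *-zeroʳ c
  *-distribˡ-∑ˡ c (x ∷ xs) f = trans (*-distribˡ-+ c (f x) _) (cong (c * f x +_) (*-distribˡ-∑ˡ c xs f))

  *-distribʳ-∑ˡ : (c : ℕ) (xs : List A) (f : A → ℕ) → ∑ˡ xs f * c ≡ ∑[ x ∈ xs ] (f x * c)
  *-distribʳ-∑ˡ c xs f = trans (*-comm _ c) (trans (*-distribˡ-∑ˡ c xs f) (∑ˡ-cong xs (λ x → *-comm c (f x))))

  ∑ˡ-++ : (xs ys : List A) (f : A → ℕ) → ∑ˡ (xs ++ ys) f ≡ ∑ˡ xs f + ∑ˡ ys f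
  ∑ˡ-++ []       ys f = refl
  ∑ˡ-++ (x ∷ xs) ys f = trans (cong (f x +_) (∑ˡ-++ xs ys f)) (sym (+-assoc (f x) _ _))

  ∑ˡ-filter : (p : A → Bool) (xs : List A) (f : A → ℕ) →
    ∑ˡ (filter (T? ∘ p) xs) f ≡ ∑[ x ∈ xs ] (𝟙 (p x) * f x)
  ∑ˡ-filter p []       f = refl
  ∑ˡ-filter p (x ∷ xs) f with p x
  ... | true  = cong₂ _+_ (sym (+-identityʳ (f x))) (∑ˡ-filter p xs f)
  ... | false = ∑ˡ-filter p xs f

  ∑ˡ-1≡length : (xs : List A) → ∑[ x ∈ xs ] 1 ≡ length xs
  ∑ˡ-1≡length []       = refl
  ∑ˡ-1≡length (_ ∷ xs) = cong suc (∑ˡ-1≡length xs)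

  count≡∑ˡ : (p : A → Bool) (xs : List A) → count p xs ≡ ∑[ x ∈ xs ] 𝟙 (p x)
  count≡∑ˡ p []       = refl
  count≡∑ˡ p (x ∷ xs) with p x
  ... | true  = cong suc (count≡∑ˡ p xs)
  ... | false = count≡∑ˡ p xs

module _ {A B : Set} where

  ∑ˡ-map : (g : A → B) (xs : List A) (f : B → ℕ) → ∑ˡ (map g xs) f ≡ ∑ˡ xs (f ∘ g)
  ∑ˡ-map g []       f = refl
  ∑ˡ-map g (x ∷ xs) f = cong (f (g x) +_) (∑ˡ-map g xs f)

  ∑ˡ-concatMap : (g : A → List B) (xs : List A) (f : B → ℕ) →
    ∑ˡ (concatMap g xs) f ≡ ∑[ x ∈ xs ] ∑ˡ (g x) f
  ∑ˡ-concatMap g []       f = refl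
  ∑ˡ-concatMap g (x ∷ xs) f = trans (∑ˡ-++ (g x) _ f) (cong (∑ˡ (g x) f +_) (∑ˡ-concatMap g xs f))

  ∑ˡ-comm : (xs : List A) (ys : List B) (F : A → B → ℕ) →
    ∑[ x ∈ xs ] ∑[ y ∈ ys ] F x y ≡ ∑[ y ∈ ys ] ∑[ x ∈ xs ] F x y
  ∑ˡ-comm []       ys F = sym (∑ˡ-zero ys (λ _ → refl))
  ∑ˡ-comm (x ∷ xs) ys F =
    trans (cong (∑ˡ ys (F x) +_) (∑ˡ-comm xs ys F)) (sym (∑ˡ-distrib-+ ys (F x) _))

∑ˡ-allFin : ∀ n (f : Fin n → ℕ) → ∑ˡ (allFin n) f ≡ ∑[ i < n ] f i
∑ˡ-allFin n f = go n id
  where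
  go : ∀ m (g : Fin m → Fin n) → ∑ˡ (tabulate g) f ≡ ∑[ i < m ] f (g i)
  go zero    g = refl
  go (suc m) g = cong (f (g zero) +_) (go m (g ∘ suc))

∏ : ∀ {n} → Vector ℕ n → ℕ
∏ = Vector.foldr _*_ 1

foldr-*-allFin : ∀ n (f : Fin n → ℕ) → foldr _*_ 1 (map f (allFin n)) ≡ ∏ f
foldr-*-allFin n f = go n id
  where
  go : ∀ m (g : Fin m → Fin n) → foldr _*_ 1 (map f (tabulate g)) ≡ ∏ (f ∘ g)
  go zero    g = refl
  go (suc m) g = cong (f (g zero) *_) (go m (g ∘ suc))

𝟙-all? : ∀ {n} {P : Fin n → Set} (P? : ∀ i → Dec (P i)) → 𝟙 (does (all? P?)) ≡ ∏ (λ i → 𝟙 (does (P? i)))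
𝟙-all? {zero}  P? = refl
𝟙-all? {suc n} P? = trans (𝟙-∧ (does (P? zero)) _) (cong (𝟙 (does (P? zero)) *_) (𝟙-all? (P? ∘ suc)))

∑< : ℕ → (ℕ → ℕ) → ℕ
∑< N f = ∑[ i < N ] f (toℕ i)

∑ˡ-upTo : ∀ N (f : ℕ → ℕ) → ∑ˡ (upTo N) f ≡ ∑< N f
∑ˡ-upTo N f = go N id
  where
  go : ∀ M (g : ℕ → ℕ) → ∑ˡ (applyUpTo g M) f ≡ ∑< M (f ∘ g)
  go zero    g = refl
  go (suc M) g = cong (f (g 0) +_) (go M (g ∘ suc))

∑<-cong : ∀ N {f g : ℕ → ℕ} → (∀ x → x < N → f x ≡ g x) → ∑< N f ≡ ∑< N g
∑<-cong N {f} {g} e = sum-cong-≗ {N} {f ∘ toℕ} {g ∘ toℕ} (λ i → e (toℕ i) (toℕ<n i))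

∑<-zero : ∀ N {f : ℕ → ℕ} → (∀ x → f x ≡ 0) → ∑< N f ≡ 0
∑<-zero N {f} e = trans (sum-cong-≗ {N} {f ∘ toℕ} (λ i → e (toℕ i))) (sum-replicate-zero N)

∑<-distrib-+ : ∀ N (f g : ℕ → ℕ) → ∑< N (λ x → f x + g x) ≡ ∑< N f + ∑< N g
∑<-distrib-+ N f g = ∑-distrib-+ {N} (f ∘ toℕ) (g ∘ toℕ)

*-distribˡ-∑< : ∀ c N (f : ℕ → ℕ) → c * ∑< N f ≡ ∑< N (λ x → c * f x)
*-distribˡ-∑< c N f = *-distribˡ-sum {N} c (f ∘ toℕ)

∑<-comm : ∀ M N (F : ℕ → ℕ → ℕ) → ∑< M (λ x → ∑< N (F x)) ≡ ∑< N (λ y → ∑< M (λ x → F x y))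
∑<-comm M N F = ∑-comm {M} {N} (λ i j → F (toℕ i) (toℕ j))

∑<-truncate : ∀ N M (f : ℕ → ℕ) → N ≤ M → (∀ x → N ≤ x → f x ≡ 0) → ∑< M f ≡ ∑< N f
∑<-truncate zero    M       f _         e = ∑<-zero M (λ x → e x z≤n)
∑<-truncate (suc N) (suc M) f (s≤s N≤M) e =
  cong (f 0 +_) (∑<-truncate N M (f ∘ suc) N≤M (λ x N≤x → e (suc x) (s≤s N≤x)))

OccursOnce : {A : Set} → DecidableEquality A → List A → A → Set
OccursOnce _≟_ ys a = ∑[ y ∈ ys ] 𝟙 (does (a ≟ y)) ≡ 1

∑<-indicator : ∀ N a → a < N → ∑< N (λ y → 𝟙 (a ≡ᵇ y)) ≡ 1
∑<-indicator (suc N) zero    _         = cong suc (∑<-zero N (λ _ → refl))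
∑<-indicator (suc N) (suc a) (s≤s a<N) = ∑<-indicator N a a<N

upTo-once : ∀ N a → a < N → OccursOnce _≟_ (upTo N) a
upTo-once N a a<N = trans (∑ˡ-upTo N _) (∑<-indicator N a a<N)

allFin-once : ∀ n (j : Fin n) → OccursOnce _≟ᶠ_ (allFin n) j
allFin-once n j = trans (∑ˡ-allFin n _) (go n j)
  where
  go : ∀ n (j : Fin n) → ∑[ i < n ] 𝟙 (does (j ≟ᶠ i)) ≡ 1
  go (suc n) zero    =
    cong suc (trans (sum-cong-≗ {n} {λ i → 𝟙 (does (zero ≟ᶠ suc i))} (λ _ → refl)) (sum-replicate-zero n))
  go (suc n) (suc j) = go n j

allVecs-suc : {A : Set} (xs : List A) (k : ℕ) (F : Vec A (suc k) → ℕ) →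
  ∑ˡ (allVecs xs (suc k)) F ≡ ∑[ x ∈ xs ] ∑[ v ∈ allVecs xs k ] F (x ∷ v)
allVecs-suc xs k F =
  trans (∑ˡ-concatMap _ xs F) (∑ˡ-cong xs (λ x → ∑ˡ-map (x ∷_) (allVecs xs k) F))

allVecs-once : {A : Set} (_≟_ : DecidableEquality A) (xs : List A) {k : ℕ} (w : Vec A k) →
  (∀ i → OccursOnce _≟_ xs (lookup w i)) → OccursOnce (≡-dec _≟_) (allVecs xs k) w
allVecs-once _≟_ xs []      _    = refl
allVecs-once _≟_ xs {suc k} (a ∷ w) once = begin
  ∑[ v ∈ allVecs xs (suc k) ] 𝟙 (does (≡-dec _≟_ (a ∷ w) v))
    ≡⟨ allVecs-suc xs k _ ⟩
  ∑[ x ∈ xs ] ∑[ v ∈ allVecs xs k ] 𝟙 (does (a ≟ x) ∧ does (≡-dec _≟_ w v))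
    ≡⟨ ∑ˡ-cong xs (λ x → ∑ˡ-cong (allVecs xs k) (λ v → 𝟙-∧ (does (a ≟ x)) _)) ⟩
  ∑[ x ∈ xs ] ∑[ v ∈ allVecs xs k ] (𝟙 (does (a ≟ x)) * 𝟙 (does (≡-dec _≟_ w v)))
    ≡⟨ ∑ˡ-cong xs (λ x → sym (*-distribˡ-∑ˡ (𝟙 (does (a ≟ x))) (allVecs xs k) _)) ⟩
  ∑[ x ∈ xs ] (𝟙 (does (a ≟ x)) * ∑[ v ∈ allVecs xs k ] 𝟙 (does (≡-dec _≟_ w v)))
    ≡⟨ ∑ˡ-cong xs (λ x → cong (𝟙 (does (a ≟ x)) *_) (allVecs-once _≟_ xs w (once ∘ suc))) ⟩
  ∑[ x ∈ xs ] (𝟙 (does (a ≟ x)) * 1)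
    ≡⟨ ∑ˡ-cong xs (λ x → *-identityʳ _) ⟩
  ∑[ x ∈ xs ] 𝟙 (does (a ≟ x))
    ≡⟨ once zero ⟩
  1 ∎
  where open ≡-Reasoning

allVecs-upTo-once : ∀ {n} k (m : Vec ℕ n) → (∀ i → lookup m i ≤ k) → OccursOnce (≡-dec _≟_) (allVecs (upTo (suc k)) n) m
allVecs-upTo-once k m bound = allVecs-once _≟_ (upTo (suc k)) m (λ i → upTo-once (suc k) (lookup m i) (s≤s (bound i)))

total : ∀ {n} → Vec ℕ n → ℕ
total {n} m = ∑[ i < n ] lookup m i

lookup≤total : ∀ {n} (m : Vec ℕ n) i → lookup m i ≤ total m
lookup≤total (x ∷ m) zero    = m≤m+n x (total m)
lookup≤total (x ∷ m) (suc i) = ≤-trans (lookup≤total m i) (m≤n+m (total m) x)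

lookup-ext : ∀ {A : Set} {n} (u v : Vec A n) → (∀ i → lookup u i ≡ lookup v i) → u ≡ v
lookup-ext u v e = trans (sym (tabulate∘lookup u)) (trans (tabulate-cong e) (tabulate∘lookup v))

module _ {B : Set} (_≈?_ : DecidableEquality B) (ys : List B) where

  private
    counted-once : ∀ (F : ℕ) {a} → (F ≢ 0 → OccursOnce _≈?_ ys a) →
      ∑[ y ∈ ys ] 𝟙 (does (a ≈? y)) * F ≡ F
    counted-once F once with F ≟ 0
    ... | yes refl = *-zeroʳ (∑[ y ∈ ys ] 𝟙 (does (_ ≈? y)))
    ... | no F≢0  = trans (cong (_* F) (once F≢0)) (*-identityˡ F)

  ∑ˡ-fibres : {A : Set} (g : A → B) (xs : List A) (F : A → ℕ) →
    (∀ x → F x ≢ 0 → OccursOnce _≈?_ ys (g x)) →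
    ∑ˡ xs F ≡ ∑[ y ∈ ys ] ∑[ x ∈ xs ] (𝟙 (does (g x ≈? y)) * F x)
  ∑ˡ-fibres g xs F once = trans
    (∑ˡ-cong xs (λ x → trans (sym (counted-once (F x) (once x))) (*-distribʳ-∑ˡ (F x) ys _)))
    (∑ˡ-comm xs ys _)

  ∑ˡ-select : (a : B) (F : B → ℕ) → (F a ≢ 0 → OccursOnce _≈?_ ys a) →
    ∑[ y ∈ ys ] (𝟙 (does (a ≈? y)) * F y) ≡ F a
  ∑ˡ-select a F once = begin
    ∑[ y ∈ ys ] (𝟙 (does (a ≈? y)) * F y)
      ≡⟨ ∑ˡ-cong ys (λ y → 𝟙-*-cong (a ≈? y) (λ a≡y → cong F (sym a≡y))) ⟩
    ∑[ y ∈ ys ] (𝟙 (does (a ≈? y)) * F a)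
      ≡⟨ *-distribʳ-∑ˡ (F a) ys _ ⟨
    ∑[ y ∈ ys ] 𝟙 (does (a ≈? y)) * F a
      ≡⟨ counted-once (F a) once ⟩
    F a ∎
    where open ≡-Reasoning

-- Power series

Series : Set
Series = ℕ → ℕ

one : Series
one zero    = 1
one (suc _) = 0

geometric : Series
geometric _ = 1

partialSums : Series → Series
partialSums α zero    = α zero
partialSums α (suc x) = α (suc x) + partialSums α x

-- For 0 < ℓ, dilatedMul ℓ α g is the series α(t^ℓ)·g(t), and dilatedTerm ℓ α g k x is the
-- contribution of α_x t^{ℓx} to its coefficient of t^k.
dilatedTerm : ℕ → Series → Series → ℕ → ℕ → ℕ
dilatedTerm ℓ α g k x = 𝟙 (ℓ * x ≤ᵇ k) * (α x * g (k ∸ ℓ * x))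

dilatedMul : ℕ → Series → Series → Series
dilatedMul ℓ α g k = ∑< (suc k) (dilatedTerm ℓ α g k)

dilatedMul-cong : ∀ ℓ {α β g h : Series} → (∀ x → α x ≡ β x) → (∀ k → g k ≡ h k) →
  ∀ k → dilatedMul ℓ α g k ≡ dilatedMul ℓ β h k
dilatedMul-cong ℓ α≗β g≗h k =
  ∑<-cong (suc k) (λ x _ → cong₂ (λ a b → 𝟙 (ℓ * x ≤ᵇ k) * (a * b)) (α≗β x) (g≗h (k ∸ ℓ * x)))

dilatedMul-extend : ∀ {ℓ} → 0 < ℓ → ∀ α g {k N} → k < N → ∑< N (dilatedTerm ℓ α g k) ≡ dilatedMul ℓ α g k
dilatedMul-extend {ℓ} 0<ℓ α g {k} {N} k<N =
  ∑<-truncate (suc k) N (dilatedTerm ℓ α g k) k<N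
    (λ x k<x → cong (_* (α x * g (k ∸ ℓ * x))) (𝟙-*≤ᵇ-beyond 0<ℓ k<x))

dilatedMul-unfold : ∀ {ℓ} → 0 < ℓ → ∀ α g k →
  dilatedMul ℓ α g k ≡ α 0 * g k + 𝟙 (ℓ ≤ᵇ k) * dilatedMul ℓ (α ∘ suc) g (k ∸ ℓ)
dilatedMul-unfold {ℓ} 0<ℓ α g k = cong₂ _+_ head tail
  where
  open ≡-Reasoning
  head : dilatedTerm ℓ α g k 0 ≡ α 0 * g k
  head rewrite *-zeroʳ ℓ = *-identityˡ _
  tail : ∑< k (dilatedTerm ℓ α g k ∘ suc) ≡ 𝟙 (ℓ ≤ᵇ k) * dilatedMul ℓ (α ∘ suc) g (k ∸ ℓ)
  tail = begin
    ∑< k (dilatedTerm ℓ α g k ∘ suc)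
      ≡⟨ ∑<-cong k (λ x _ → shift x) ⟩
    ∑< k (λ x → 𝟙 (ℓ ≤ᵇ k) * dilatedTerm ℓ (α ∘ suc) g (k ∸ ℓ) x)
      ≡⟨ *-distribˡ-∑< (𝟙 (ℓ ≤ᵇ k)) k (dilatedTerm ℓ (α ∘ suc) g (k ∸ ℓ)) ⟨
    𝟙 (ℓ ≤ᵇ k) * ∑< k (dilatedTerm ℓ (α ∘ suc) g (k ∸ ℓ))
      ≡⟨ 𝟙-*-cong (ℓ ≤? k) (λ ℓ≤k → dilatedMul-extend 0<ℓ (α ∘ suc) g (∸-monoʳ-< 0<ℓ ℓ≤k)) ⟩
    𝟙 (ℓ ≤ᵇ k) * dilatedMul ℓ (α ∘ suc) g (k ∸ ℓ) ∎
    where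
    shift : ∀ x → dilatedTerm ℓ α g k (suc x) ≡ 𝟙 (ℓ ≤ᵇ k) * dilatedTerm ℓ (α ∘ suc) g (k ∸ ℓ) x
    shift x rewrite *-suc ℓ x | 𝟙-+≤ᵇ ℓ (ℓ * x) k | ∸-+-assoc k ℓ (ℓ * x) =
      *-assoc (𝟙 (ℓ ≤ᵇ k)) _ _

dilatedMul-distribʳ-+ : ∀ ℓ α β g k →
  dilatedMul ℓ (λ x → α x + β x) g k ≡ dilatedMul ℓ α g k + dilatedMul ℓ β g k
dilatedMul-distribʳ-+ ℓ α β g k =
  trans (∑<-cong (suc k) (λ x _ → distrib x)) (∑<-distrib-+ (suc k) (dilatedTerm ℓ α g k) (dilatedTerm ℓ β g k))
  where
  distrib : ∀ x → dilatedTerm ℓ (λ x → α x + β x) g k x ≡ dilatedTerm ℓ α g k x + dilatedTerm ℓ β g k x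
  distrib x = trans (cong (𝟙 (ℓ * x ≤ᵇ k) *_) (*-distribʳ-+ (g (k ∸ ℓ * x)) (α x) (β x)))
                    (*-distribˡ-+ (𝟙 (ℓ * x ≤ᵇ k)) _ _)

dilatedMul-zeroˡ : ∀ ℓ g k → dilatedMul ℓ (λ _ → 0) g k ≡ 0
dilatedMul-zeroˡ ℓ g k = ∑<-zero (suc k) (λ x → *-zeroʳ (𝟙 (ℓ * x ≤ᵇ k)))

dilatedMul-identityˡ : ∀ {ℓ} → 0 < ℓ → ∀ g k → dilatedMul ℓ one g k ≡ g k
dilatedMul-identityˡ {ℓ} 0<ℓ g k = begin
  dilatedMul ℓ one g k
    ≡⟨ dilatedMul-unfold 0<ℓ one g k ⟩
  1 * g k + 𝟙 (ℓ ≤ᵇ k) * dilatedMul ℓ (λ _ → 0) g (k ∸ ℓ)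
    ≡⟨ cong₂ _+_ (*-identityˡ (g k)) (cong (𝟙 (ℓ ≤ᵇ k) *_) (dilatedMul-zeroˡ ℓ g (k ∸ ℓ))) ⟩
  g k + 𝟙 (ℓ ≤ᵇ k) * 0
    ≡⟨ cong (g k +_) (*-zeroʳ (𝟙 (ℓ ≤ᵇ k))) ⟩
  g k + 0
    ≡⟨ +-identityʳ (g k) ⟩
  g k ∎
  where open ≡-Reasoning

dilatedMul² : ∀ ℓ α {m} → 0 < m → ∀ β g k →
  dilatedMul ℓ α (dilatedMul m β g) k ≡
  ∑< (suc k) (λ x → ∑< (suc k) (λ y → 𝟙 (ℓ * x + m * y ≤ᵇ k) * (α x * β y * g (k ∸ (ℓ * x + m * y)))))
dilatedMul² ℓ α {m} 0<m β g k = ∑<-cong (suc k) (λ x _ → begin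
  𝟙 (ℓ * x ≤ᵇ k) * (α x * dilatedMul m β g (k ∸ ℓ * x))
    ≡⟨ cong (λ s → 𝟙 (ℓ * x ≤ᵇ k) * (α x * s)) (dilatedMul-extend 0<m β g (s≤s (m∸n≤m k (ℓ * x)))) ⟨
  𝟙 (ℓ * x ≤ᵇ k) * (α x * ∑< (suc k) (dilatedTerm m β g (k ∸ ℓ * x)))
    ≡⟨ cong (𝟙 (ℓ * x ≤ᵇ k) *_) (*-distribˡ-∑< (α x) (suc k) (dilatedTerm m β g (k ∸ ℓ * x))) ⟩
  𝟙 (ℓ * x ≤ᵇ k) * ∑< (suc k) (λ y → α x * dilatedTerm m β g (k ∸ ℓ * x) y)
    ≡⟨ *-distribˡ-∑< (𝟙 (ℓ * x ≤ᵇ k)) (suc k) (λ y → α x * dilatedTerm m β g (k ∸ ℓ * x) y) ⟩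
  ∑< (suc k) (λ y → 𝟙 (ℓ * x ≤ᵇ k) * (α x * dilatedTerm m β g (k ∸ ℓ * x) y))
    ≡⟨ ∑<-cong (suc k) (λ y _ → merge x y) ⟩
  ∑< (suc k) (λ y → 𝟙 (ℓ * x + m * y ≤ᵇ k) * (α x * β y * g (k ∸ (ℓ * x + m * y)))) ∎)
  where
  open ≡-Reasoning
  merge : ∀ x y → 𝟙 (ℓ * x ≤ᵇ k) * (α x * dilatedTerm m β g (k ∸ ℓ * x) y) ≡
                  𝟙 (ℓ * x + m * y ≤ᵇ k) * (α x * β y * g (k ∸ (ℓ * x + m * y)))
  merge x y rewrite 𝟙-+≤ᵇ (ℓ * x) (m * y) k | ∸-+-assoc k (ℓ * x) (m * y) =
    rearrange (𝟙 (ℓ * x ≤ᵇ k)) (α x) (𝟙 (m * y ≤ᵇ k ∸ ℓ * x)) (β y) (g (k ∸ (ℓ * x + m * y)))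
    where
    rearrange : ∀ a b c d e → a * (b * (c * (d * e))) ≡ a * c * (b * d * e)
    rearrange = solve-∀

dilatedMul-comm : ∀ {ℓ m} → 0 < ℓ → 0 < m → ∀ α β g k →
  dilatedMul ℓ α (dilatedMul m β g) k ≡ dilatedMul m β (dilatedMul ℓ α g) k
dilatedMul-comm {ℓ} {m} 0<ℓ 0<m α β g k = begin
  dilatedMul ℓ α (dilatedMul m β g) k
    ≡⟨ dilatedMul² ℓ α 0<m β g k ⟩
  ∑< (suc k) (λ x → ∑< (suc k) (λ y → 𝟙 (ℓ * x + m * y ≤ᵇ k) * (α x * β y * g (k ∸ (ℓ * x + m * y)))))
    ≡⟨ ∑<-comm (suc k) (suc k) (λ x y → 𝟙 (ℓ * x + m * y ≤ᵇ k) * (α x * β y * g (k ∸ (ℓ * x + m * y)))) ⟩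
  ∑< (suc k) (λ y → ∑< (suc k) (λ x → 𝟙 (ℓ * x + m * y ≤ᵇ k) * (α x * β y * g (k ∸ (ℓ * x + m * y)))))
    ≡⟨ ∑<-cong (suc k) (λ y _ → ∑<-cong (suc k) (λ x _ → swap x y)) ⟩
  ∑< (suc k) (λ y → ∑< (suc k) (λ x → 𝟙 (m * y + ℓ * x ≤ᵇ k) * (β y * α x * g (k ∸ (m * y + ℓ * x)))))
    ≡⟨ dilatedMul² m β 0<ℓ α g k ⟨
  dilatedMul m β (dilatedMul ℓ α g) k ∎
  where
  open ≡-Reasoning
  swap : ∀ x y → 𝟙 (ℓ * x + m * y ≤ᵇ k) * (α x * β y * g (k ∸ (ℓ * x + m * y))) ≡
                 𝟙 (m * y + ℓ * x ≤ᵇ k) * (β y * α x * g (k ∸ (m * y + ℓ * x)))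
  swap x y rewrite +-comm (ℓ * x) (m * y) | *-comm (α x) (β y) = refl

recurrence-unique : ∀ {ℓ} → 0 < ℓ → ∀ (h u v : Series) →
  (∀ k → u k ≡ h k + 𝟙 (ℓ ≤ᵇ k) * u (k ∸ ℓ)) →
  (∀ k → v k ≡ h k + 𝟙 (ℓ ≤ᵇ k) * v (k ∸ ℓ)) →
  ∀ k → u k ≡ v k
recurrence-unique {ℓ} 0<ℓ h u v u-rec v-rec = <-rec (λ k → u k ≡ v k) step
  where
  step : ∀ k → (∀ {j} → j < k → u j ≡ v j) → u k ≡ v k
  step k ih = begin
    u k                          ≡⟨ u-rec k ⟩
    h k + 𝟙 (ℓ ≤ᵇ k) * u (k ∸ ℓ) ≡⟨ cong (h k +_) (𝟙-*-cong (ℓ ≤? k) (λ ℓ≤k → ih (∸-monoʳ-< 0<ℓ ℓ≤k))) ⟩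
    h k + 𝟙 (ℓ ≤ᵇ k) * v (k ∸ ℓ) ≡⟨ v-rec k ⟨
    v k                          ∎
    where open ≡-Reasoning

dilatedMul-geometric : ∀ {ℓ} → 0 < ℓ → ∀ g k →
  dilatedMul ℓ geometric g k ≡ g k + 𝟙 (ℓ ≤ᵇ k) * dilatedMul ℓ geometric g (k ∸ ℓ)
dilatedMul-geometric {ℓ} 0<ℓ g k =
  trans (dilatedMul-unfold 0<ℓ geometric g k)
        (cong (_+ 𝟙 (ℓ ≤ᵇ k) * dilatedMul ℓ geometric g (k ∸ ℓ)) (*-identityˡ (g k)))

-- Both sides solve u k = dilatedMul ℓ β g k + [ℓ ≤ k] u (k ∸ ℓ).
dilatedMul-partialSums : ∀ {ℓ} → 0 < ℓ → ∀ β g k →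
  dilatedMul ℓ (partialSums β) g k ≡ dilatedMul ℓ geometric (dilatedMul ℓ β g) k
dilatedMul-partialSums {ℓ} 0<ℓ β g =
  recurrence-unique 0<ℓ (dilatedMul ℓ β g) _ _ u-rec (dilatedMul-geometric 0<ℓ (dilatedMul ℓ β g))
  where
  u = dilatedMul ℓ (partialSums β) g
  u-rec : ∀ k → u k ≡ dilatedMul ℓ β g k + 𝟙 (ℓ ≤ᵇ k) * u (k ∸ ℓ)
  u-rec k = begin
    u k
      ≡⟨ dilatedMul-unfold 0<ℓ (partialSums β) g k ⟩
    β 0 * g k + i * dilatedMul ℓ (λ x → β (suc x) + partialSums β x) g (k ∸ ℓ)
      ≡⟨ cong (λ s → β 0 * g k + i * s) (dilatedMul-distribʳ-+ ℓ (β ∘ suc) (partialSums β) g (k ∸ ℓ)) ⟩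
    β 0 * g k + i * (dilatedMul ℓ (β ∘ suc) g (k ∸ ℓ) + u (k ∸ ℓ))
      ≡⟨ cong (β 0 * g k +_) (*-distribˡ-+ i _ _) ⟩
    β 0 * g k + (i * dilatedMul ℓ (β ∘ suc) g (k ∸ ℓ) + i * u (k ∸ ℓ))
      ≡⟨ +-assoc (β 0 * g k) _ _ ⟨
    β 0 * g k + i * dilatedMul ℓ (β ∘ suc) g (k ∸ ℓ) + i * u (k ∸ ℓ)
      ≡⟨ cong (_+ i * u (k ∸ ℓ)) (dilatedMul-unfold 0<ℓ β g k) ⟨
    dilatedMul ℓ β g k + i * u (k ∸ ℓ) ∎
    where
    open ≡-Reasoning
    i = 𝟙 (ℓ ≤ᵇ k)

-- binomSC s c is the coefficient of t^s in (1 - t)^(-c)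

binomSC-zero : ∀ s → binomSC s 0 ≡ one s
binomSC-zero zero    = refl
binomSC-zero (suc s) = trans (cong (_C suc s) (+-identityʳ s)) (k>n⇒nCk≡0 (n<1+n s))

binomSC-suc : ∀ s c → binomSC s (suc c) ≡ (s + c) C s
binomSC-suc zero    c = refl
binomSC-suc (suc s) c = cong (_C suc s) (+-suc s c)

binomSC-pascal : ∀ s c → binomSC (suc s) (suc c) ≡ binomSC (suc s) c + binomSC s (suc c)
binomSC-pascal s c = begin
  (s + suc c) C suc s                 ≡⟨ cong (_C suc s) (+-suc s c) ⟩
  suc (s + c) C suc s                 ≡⟨ nCk+nC[k+1]≡[n+1]C[k+1] (s + c) s ⟨
  (s + c) C s + (s + c) C suc s       ≡⟨ +-comm ((s + c) C s) _ ⟩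
  (s + c) C suc s + (s + c) C s       ≡⟨ cong ((s + c) C suc s +_) (binomSC-suc s c) ⟨
  binomSC (suc s) c + binomSC s (suc c) ∎
  where open ≡-Reasoning

partialSums-binomSC : ∀ c s → partialSums (λ x → binomSC x c) s ≡ binomSC s (suc c)
partialSums-binomSC c zero    = refl
partialSums-binomSC c (suc s) =
  trans (cong (binomSC (suc s) c +_) (partialSums-binomSC c s)) (sym (binomSC-pascal s c))

dilatedProd : ∀ {n} → Vector ℕ n → Vector Series n → Series
dilatedProd {zero}  w α = one
dilatedProd {suc n} w α = dilatedMul (w zero) (α zero) (dilatedProd (w ∘ suc) (α ∘ suc))

dilatedProd-cong : ∀ {n} (w : Vector ℕ n) {α β : Vector Series n} → (∀ i x → α i x ≡ β i x) →
  ∀ k → dilatedProd w α k ≡ dilatedProd w β k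
dilatedProd-cong {zero}  w α≗β k = refl
dilatedProd-cong {suc n} w α≗β =
  dilatedMul-cong (w zero) (α≗β zero) (dilatedProd-cong (w ∘ suc) (α≗β ∘ suc))

dilatedProd-one : ∀ {n} (w : Vector ℕ n) → (∀ i → 0 < w i) → ∀ k → dilatedProd w (λ _ → one) k ≡ one k
dilatedProd-one {zero}  w w>0 k = refl
dilatedProd-one {suc n} w w>0 k =
  trans (dilatedMul-cong (w zero) {one} {one} (λ _ → refl) (dilatedProd-one (w ∘ suc) (w>0 ∘ suc)) k)
        (dilatedMul-identityˡ (w>0 zero) one k)

∑ˡ-𝟙-+≡ᵇ : {A : Set} (vs : List A) (W P : A → ℕ) (a c k : ℕ) →
  ∑[ v ∈ vs ] (𝟙 (a + W v ≡ᵇ k) * (c * P v)) ≡ 𝟙 (a ≤ᵇ k) * (c * ∑[ v ∈ vs ] (𝟙 (W v ≡ᵇ k ∸ a) * P v))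
∑ˡ-𝟙-+≡ᵇ vs W P a c k = begin
  ∑[ v ∈ vs ] (𝟙 (a + W v ≡ᵇ k) * (c * P v))
    ≡⟨ ∑ˡ-cong vs (λ v → trans (cong (_* (c * P v)) (𝟙-+≡ᵇ a (W v) k))
                               (rearrange (𝟙 (a ≤ᵇ k)) (𝟙 (W v ≡ᵇ k ∸ a)) c (P v))) ⟩
  ∑[ v ∈ vs ] (𝟙 (a ≤ᵇ k) * c * (𝟙 (W v ≡ᵇ k ∸ a) * P v))
    ≡⟨ *-distribˡ-∑ˡ (𝟙 (a ≤ᵇ k) * c) vs _ ⟨
  𝟙 (a ≤ᵇ k) * c * ∑[ v ∈ vs ] (𝟙 (W v ≡ᵇ k ∸ a) * P v)
    ≡⟨ *-assoc (𝟙 (a ≤ᵇ k)) c _ ⟩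
  𝟙 (a ≤ᵇ k) * (c * ∑[ v ∈ vs ] (𝟙 (W v ≡ᵇ k ∸ a) * P v)) ∎
  where
  open ≡-Reasoning
  rearrange : ∀ x y z w → x * y * (z * w) ≡ x * z * (y * w)
  rearrange = solve-∀

coeff-dilatedProd : ∀ {n} (w : Vector ℕ n) → (∀ i → 0 < w i) → (α : Vector Series n) → ∀ {k K} → k < K →
  ∑[ s ∈ allVecs (upTo K) n ] (𝟙 (∑[ i < n ] (w i * lookup s i) ≡ᵇ k) * ∏ (λ i → α i (lookup s i)))
    ≡ dilatedProd w α k
coeff-dilatedProd {zero}  w w>0 α {zero}  k<K = refl
coeff-dilatedProd {zero}  w w>0 α {suc k} k<K = refl
coeff-dilatedProd {suc n} w w>0 α {k} {K} k<K = begin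
  ∑[ s ∈ allVecs (upTo K) (suc n) ] (𝟙 (∑[ i < suc n ] (w i * lookup s i) ≡ᵇ k) * ∏ (λ i → α i (lookup s i)))
    ≡⟨ allVecs-suc (upTo K) n _ ⟩
  ∑[ x ∈ upTo K ] ∑[ v ∈ Vs ] (𝟙 (ℓ * x + W v ≡ᵇ k) * (α zero x * Π v))
    ≡⟨ ∑ˡ-cong (upTo K) factor ⟩
  ∑[ x ∈ upTo K ] dilatedTerm ℓ (α zero) P k x
    ≡⟨ ∑ˡ-upTo K _ ⟩
  ∑< K (dilatedTerm ℓ (α zero) P k)
    ≡⟨ dilatedMul-extend (w>0 zero) (α zero) P k<K ⟩
  dilatedMul ℓ (α zero) P k ∎
  where
  open ≡-Reasoning
  ℓ = w zero
  Vs = allVecs (upTo K) n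
  W Π : Vec ℕ n → ℕ
  W v = ∑[ i < n ] (w (suc i) * lookup v i)
  Π v = ∏ (λ i → α (suc i) (lookup v i))
  P = dilatedProd (w ∘ suc) (α ∘ suc)
  factor : ∀ x → ∑[ v ∈ Vs ] (𝟙 (ℓ * x + W v ≡ᵇ k) * (α zero x * Π v)) ≡ dilatedTerm ℓ (α zero) P k x
  factor x = trans (∑ˡ-𝟙-+≡ᵇ Vs W Π (ℓ * x) (α zero x) k) (cong (λ s → 𝟙 (ℓ * x ≤ᵇ k) * (α zero x * s))
    (coeff-dilatedProd (w ∘ suc) (w>0 ∘ suc) (α ∘ suc) (≤-<-trans (m∸n≤m k (ℓ * x)) k<K)))

dilatedMul-geometric-dilatedProd : ∀ {n} (w : Vector ℕ n) → (∀ i → 0 < w i) → (α : Vector Series n) →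
  ∀ j {ℓ} → w j ≡ ℓ → ∀ k → dilatedMul ℓ geometric (dilatedProd w α) k ≡ dilatedProd w (updateAt α j partialSums) k
dilatedMul-geometric-dilatedProd w w>0 α zero    refl k =
  sym (dilatedMul-partialSums (w>0 zero) (α zero) (dilatedProd (w ∘ suc) (α ∘ suc)) k)
dilatedMul-geometric-dilatedProd w w>0 α (suc j) refl k = begin
  dilatedMul (w (suc j)) geometric (dilatedMul (w zero) (α zero) P) k
    ≡⟨ dilatedMul-comm (w>0 (suc j)) (w>0 zero) geometric (α zero) P k ⟩
  dilatedMul (w zero) (α zero) (dilatedMul (w (suc j)) geometric P) k
    ≡⟨ dilatedMul-cong (w zero) {α zero} {α zero} (λ _ → refl)
         (dilatedMul-geometric-dilatedProd (w ∘ suc) (w>0 ∘ suc) (α ∘ suc) j refl) k ⟩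
  dilatedMul (w zero) (α zero) (dilatedProd (w ∘ suc) (updateAt (α ∘ suc) j partialSums)) k ∎
  where
  open ≡-Reasoning
  P = dilatedProd (w ∘ suc) (α ∘ suc)

-- ∏_{ℓ = 1}^{n} (1 - t^ℓ)^(-c ℓ)
binomialProd : ℕ → (ℕ → ℕ) → Series
binomialProd n c = dilatedProd {n} (suc ∘ toℕ) (λ j s → binomSC s (c (suc (toℕ j))))

binomialProd-zero : ∀ n k → binomialProd n (λ _ → 0) k ≡ one k
binomialProd-zero n k =
  trans (dilatedProd-cong {n} (suc ∘ toℕ) (λ _ → binomSC-zero) k) (dilatedProd-one {n} (suc ∘ toℕ) (λ _ → z<s) k)

binomialProd-cong : ∀ n {c d : ℕ → ℕ} → (∀ ℓ → c ℓ ≡ d ℓ) → ∀ k → binomialProd n c k ≡ binomialProd n d k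
binomialProd-cong n c≗d = dilatedProd-cong {n} (suc ∘ toℕ) (λ j s → cong (binomSC s) (c≗d (suc (toℕ j))))

dilatedMul-geometric-binomialProd : ∀ {n ℓ} → 0 < ℓ → ℓ ≤ n → ∀ c k →
  dilatedMul ℓ geometric (binomialProd n c) k ≡ binomialProd n (λ ℓ′ → 𝟙 (ℓ ≡ᵇ ℓ′) + c ℓ′) k
dilatedMul-geometric-binomialProd {n} {suc p} _ p<n c k = begin
  dilatedMul (suc p) geometric (binomialProd n c) k
    ≡⟨ dilatedMul-geometric-dilatedProd {n} (suc ∘ toℕ) (λ _ → z<s) α j (cong suc (toℕ-fromℕ< p<n)) k ⟩
  dilatedProd {n} (suc ∘ toℕ) (updateAt α j partialSums) k
    ≡⟨ dilatedProd-cong {n} (suc ∘ toℕ) updated k ⟩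
  binomialProd n (λ ℓ′ → 𝟙 (suc p ≡ᵇ ℓ′) + c ℓ′) k ∎
  where
  open ≡-Reasoning
  α : Vector Series n
  α i s = binomSC s (c (suc (toℕ i)))
  j = fromℕ< p<n
  updated : ∀ i s → updateAt α j partialSums i s ≡ binomSC s (𝟙 (p ≡ᵇ toℕ i) + c (suc (toℕ i)))
  updated i s with i ≟ᶠ j
  ... | yes refl = begin
    updateAt α j partialSums j s        ≡⟨ cong (_$ s) (updateAt-updates j α) ⟩
    partialSums (α j) s                 ≡⟨ partialSums-binomSC (c (suc (toℕ j))) s ⟩
    binomSC s (1 + c (suc (toℕ j)))     ≡⟨ cong (λ z → binomSC s (z + c (suc (toℕ j)))) p≡j ⟨
    binomSC s (𝟙 (p ≡ᵇ toℕ j) + c (suc (toℕ j))) ∎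
    where
    p≡j : 𝟙 (p ≡ᵇ toℕ j) ≡ 1
    p≡j = 𝟙-yes (p ≟ toℕ j) (sym (toℕ-fromℕ< p<n))
  ... | no i≢j = begin
    updateAt α j partialSums i s        ≡⟨ cong (_$ s) (updateAt-minimal i j α i≢j) ⟩
    binomSC s (c (suc (toℕ i)))         ≡⟨ cong (λ z → binomSC s (z + c (suc (toℕ i)))) p≢i ⟨
    binomSC s (𝟙 (p ≡ᵇ toℕ i) + c (suc (toℕ i))) ∎
    where
    p≢i : 𝟙 (p ≡ᵇ toℕ i) ≡ 0
    p≢i = 𝟙-no (p ≟ toℕ i) (λ p≡i → i≢j (toℕ-injective (trans (sym p≡i) (sym (toℕ-fromℕ< p<n)))))

-- λ s → 𝟙 (b ∨ (s ≡ᵇ 0)) is the series 1/(1 - t) if b holds and 1 otherwise.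
dilatedMul-binomialProd : ∀ {n ℓ} → 0 < ℓ → ℓ ≤ n → ∀ b c k →
  dilatedMul ℓ (λ s → 𝟙 (b ∨ (s ≡ᵇ 0))) (binomialProd n c) k ≡
  binomialProd n (λ ℓ′ → 𝟙 ((ℓ ≡ᵇ ℓ′) ∧ b) + c ℓ′) k
dilatedMul-binomialProd {n} {ℓ} 0<ℓ ℓ≤n true c k =
  trans (dilatedMul-geometric-binomialProd 0<ℓ ℓ≤n c k)
        (binomialProd-cong n (λ ℓ′ → cong (λ b → 𝟙 b + c ℓ′) (sym (∧-identityʳ (ℓ ≡ᵇ ℓ′)))) k)
dilatedMul-binomialProd {n} {ℓ} 0<ℓ ℓ≤n false c k = begin
  dilatedMul ℓ (λ s → 𝟙 (s ≡ᵇ 0)) (binomialProd n c) k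
    ≡⟨ dilatedMul-cong ℓ {λ s → 𝟙 (s ≡ᵇ 0)} {one} {binomialProd n c} {binomialProd n c}
                       (λ { zero → refl ; (suc _) → refl }) (λ _ → refl) k ⟩
  dilatedMul ℓ one (binomialProd n c) k
    ≡⟨ dilatedMul-identityˡ 0<ℓ (binomialProd n c) k ⟩
  binomialProd n c k
    ≡⟨ binomialProd-cong n (λ ℓ′ → cong (λ b → 𝟙 b + c ℓ′) (∧-zeroʳ (ℓ ≡ᵇ ℓ′))) k ⟨
  binomialProd n (λ ℓ′ → 𝟙 ((ℓ ≡ᵇ ℓ′) ∧ false) + c ℓ′) k ∎
  where open ≡-Reasoning

multiplicity : ∀ {m} → Vector ℕ m → Vector Bool m → ℕ → ℕ
multiplicity {m} u b ℓ = ∑[ i < m ] 𝟙 ((u i ≡ᵇ ℓ) ∧ b i)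

geometricProd≡binomialProd : ∀ n {m} (u : Vector ℕ m) (b : Vector Bool m) → (∀ i → 0 < u i × u i ≤ n) →
  ∀ k → dilatedProd u (λ i s → 𝟙 (b i ∨ (s ≡ᵇ 0))) k ≡ binomialProd n (multiplicity u b) k
geometricProd≡binomialProd n {zero}  u b bounds k = sym (binomialProd-zero n k)
geometricProd≡binomialProd n {suc m} u b bounds k = trans
  (dilatedMul-cong (u zero) {α₀} {α₀} (λ _ → refl)
     (geometricProd≡binomialProd n (u ∘ suc) (b ∘ suc) (bounds ∘ suc)) k)
  (dilatedMul-binomialProd (proj₁ (bounds zero)) (proj₂ (bounds zero)) (b zero)
     (multiplicity (u ∘ suc) (b ∘ suc)) k)
  where
  α₀ : Series
  α₀ s = 𝟙 (b zero ∨ (s ≡ᵇ 0))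

rhs≡binomialProd : ∀ n k c → rhs n k c ≡ binomialProd n c k
rhs≡binomialProd n k c = begin
  rhs n k c
    ≡⟨ ∑ˡ-filter (λ s → weightedSum s ≡ᵇ k) Vs (prodBinom c) ⟩
  ∑[ s ∈ Vs ] (𝟙 (weightedSum s ≡ᵇ k) * prodBinom c s)
    ≡⟨ ∑ˡ-cong Vs (λ s → cong₂ (λ a b → 𝟙 (a ≡ᵇ k) * b) (∑ˡ-allFin n _) (foldr-*-allFin n _)) ⟩
  ∑[ s ∈ Vs ] (𝟙 (∑[ i < n ] (suc (toℕ i) * lookup s i) ≡ᵇ k) * ∏ (λ i → binomSC (lookup s i) (c (suc (toℕ i)))))
    ≡⟨ coeff-dilatedProd {n} (suc ∘ toℕ) (λ _ → z<s) (λ i s → binomSC s (c (suc (toℕ i)))) {k} ≤-refl ⟩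
  binomialProd n c k ∎
  where
  open ≡-Reasoning
  Vs = allVecs (upTo (suc k)) n

-- Multisets

module _ {n : ℕ} where

  Sorted : ∀ {k} → Vec (Fin n) k → Set
  Sorted t = T (weaklyIncreasing t)

  occ : ∀ {k} → Fin n → Vec (Fin n) k → ℕ
  occ j []      = 0
  occ j (x ∷ t) = 𝟙 (does (x ≟ᶠ j)) + occ j t

  multiplicities : ∀ {k} → Vec (Fin n) k → Vec ℕ n
  multiplicities t = Vec.tabulate (λ j → occ j t)

  sorted-tail : ∀ {k} x (t : Vec (Fin n) k) → Sorted (x ∷ t) → Sorted t
  sorted-tail x []      _ = _
  sorted-tail x (y ∷ t) s = proj₂ (Equivalence.to T-∧ s)

  sorted-head : ∀ {k} x y (t : Vec (Fin n) k) → Sorted (x ∷ y ∷ t) → toℕ x ≤ toℕ y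
  sorted-head x y t s = ≤ᵇ⇒≤ (toℕ x) (toℕ y) (proj₁ (Equivalence.to T-∧ s))

  sorted-cons : ∀ {k} x y (t : Vec (Fin n) k) → toℕ x ≤ toℕ y → Sorted (y ∷ t) → Sorted (x ∷ y ∷ t)
  sorted-cons x y t x≤y s = Equivalence.from T-∧ (≤⇒≤ᵇ x≤y , s)

  private
    ≤ᶠ-true : ∀ {x y : Fin n} → (x ≤ᶠ y) ≡ true → toℕ x ≤ toℕ y
    ≤ᶠ-true {x} {y} eq = ≤ᵇ⇒≤ (toℕ x) (toℕ y) (subst T (sym eq) _)

    ≤ᶠ-false : ∀ {x y : Fin n} → (x ≤ᶠ y) ≡ false → toℕ y ≤ toℕ x
    ≤ᶠ-false {x} {y} eq = ≰⇒≥ (λ x≤y → subst T eq (≤⇒≤ᵇ x≤y))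

  insert-behind-sorted : ∀ {k} y x (ys : Vec (Fin n) k) → toℕ y ≤ toℕ x → Sorted (y ∷ ys) → Sorted (y ∷ insert x ys)
  insert-behind-sorted y x []       y≤x _ = sorted-cons y x [] y≤x _
  insert-behind-sorted y x (z ∷ zs) y≤x s with x ≤ᶠ z in eq
  ... | true  = sorted-cons y x (z ∷ zs) y≤x (sorted-cons x z zs (≤ᶠ-true eq) (sorted-tail y (z ∷ zs) s))
  ... | false = sorted-cons y z (insert x zs) (sorted-head y z zs s)
                  (insert-behind-sorted z x zs (≤ᶠ-false eq) (sorted-tail y (z ∷ zs) s))

  insert-sorted : ∀ {k} x (ys : Vec (Fin n) k) → Sorted ys → Sorted (insert x ys)
  insert-sorted x []       _ = _
  insert-sorted x (y ∷ ys) s with x ≤ᶠ y in eq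
  ... | true  = sorted-cons x y ys (≤ᶠ-true eq) s
  ... | false = insert-behind-sorted y x ys (≤ᶠ-false eq) s

  sortV-sorted : ∀ {k} (t : Vec (Fin n) k) → Sorted (sortV t)
  sortV-sorted []      = _
  sortV-sorted (x ∷ t) = insert-sorted x (sortV t) (sortV-sorted t)

  occ-insert : ∀ {k} j x (ys : Vec (Fin n) k) → occ j (insert x ys) ≡ occ j (x ∷ ys)
  occ-insert j x []       = refl
  occ-insert j x (y ∷ ys) with x ≤ᶠ y
  ... | true  = refl
  ... | false = trans (cong (𝟙 (does (y ≟ᶠ j)) +_) (occ-insert j x ys))
                      (x+[y+z]≡y+[x+z] (𝟙 (does (y ≟ᶠ j))) (𝟙 (does (x ≟ᶠ j))) (occ j ys))
    where
    x+[y+z]≡y+[x+z] : ∀ a b c → a + (b + c) ≡ b + (a + c)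
    x+[y+z]≡y+[x+z] = solve-∀

  occ-sortV : ∀ {k} j (t : Vec (Fin n) k) → occ j (sortV t) ≡ occ j t
  occ-sortV j []      = refl
  occ-sortV j (x ∷ t) = trans (occ-insert j x (sortV t)) (cong (𝟙 (does (x ≟ᶠ j)) +_) (occ-sortV j t))

  private
    occ-self : ∀ {k} x (t : Vec (Fin n) k) → occ x (x ∷ t) ≢ 0
    occ-self x t rewrite 𝟙-yes (x ≟ᶠ x) refl = λ ()

  sorted-head-minimal : ∀ {k} x (t : Vec (Fin n) k) z → Sorted (x ∷ t) → occ z (x ∷ t) ≢ 0 → toℕ x ≤ toℕ z
  sorted-head-minimal x t z s z∈ with x ≟ᶠ z
  ... | yes refl = ≤-refl
  sorted-head-minimal x []      z s z∈ | no _ = contradiction refl z∈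
  sorted-head-minimal x (y ∷ t) z s z∈ | no _ =
    ≤-trans (sorted-head x y t s) (sorted-head-minimal y t z (sorted-tail x (y ∷ t) s) z∈)

  sorted-unique : ∀ {k} (t u : Vec (Fin n) k) → Sorted t → Sorted u → (∀ j → occ j t ≡ occ j u) → t ≡ u
  sorted-unique []      []      _  _  _    = refl
  sorted-unique (x ∷ t) (y ∷ u) st su same = cong₂ _∷_ x≡y
    (sorted-unique t u (sorted-tail x t st) (sorted-tail y u su) λ j →
      +-cancelˡ-≡ _ (occ j t) (occ j u) (trans (same j) (cong (λ z → 𝟙 (does (z ≟ᶠ j)) + occ j u) (sym x≡y))))
    where
    x≡y : x ≡ y
    x≡y = toℕ-injective (≤-antisym
      (sorted-head-minimal x t y st (λ p → occ-self y u (trans (sym (same y)) p)))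
      (sorted-head-minimal y u x su (λ p → occ-self x t (trans (same x) p))))

  occ-map : ∀ {k} (σ : Permutation′ n) j (t : Vec (Fin n) k) → occ j (Vec.map (σ ⟨$⟩ʳ_) t) ≡ occ (σ ⟨$⟩ˡ j) t
  occ-map σ j []      = refl
  occ-map σ j (x ∷ t) = cong₂ _+_
    (𝟙-⇔ (σ ⟨$⟩ʳ x ≟ᶠ j) (x ≟ᶠ σ ⟨$⟩ˡ j) $ mk⇔
      (λ e → trans (sym (inverseˡ σ)) (cong (σ ⟨$⟩ˡ_) e))
      (λ e → trans (cong (σ ⟨$⟩ʳ_) e) (inverseʳ σ)))
    (occ-map σ j t)

  occ-++ : ∀ {a b} j (u : Vec (Fin n) a) (v : Vec (Fin n) b) → occ j (u Vec.++ v) ≡ occ j u + occ j v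
  occ-++ j []      v = refl
  occ-++ j (x ∷ u) v = trans (cong (𝟙 (does (x ≟ᶠ j)) +_) (occ-++ j u v)) (sym (+-assoc _ (occ j u) (occ j v)))

  occ≤length : ∀ {k} j (t : Vec (Fin n) k) → occ j t ≤ k
  occ≤length j []      = z≤n
  occ≤length j (x ∷ t) = +-mono-≤ (𝟙≤1 (does (x ≟ᶠ j))) (occ≤length j t)

  ∑-occ : ∀ {k} (t : Vec (Fin n) k) → ∑[ j < n ] occ j t ≡ k
  ∑-occ []      = trans (sum-cong-≗ {n} {λ j → occ j []} (λ _ → refl)) (sum-replicate-zero n)
  ∑-occ (x ∷ t) = begin
    ∑[ j < n ] (𝟙 (does (x ≟ᶠ j)) + occ j t)
      ≡⟨ ∑-distrib-+ {n} (λ j → 𝟙 (does (x ≟ᶠ j))) (λ j → occ j t) ⟩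
    ∑[ j < n ] 𝟙 (does (x ≟ᶠ j)) + ∑[ j < n ] occ j t
      ≡⟨ cong₂ _+_ (trans (sym (∑ˡ-allFin n _)) (allFin-once n x)) (∑-occ t) ⟩
    suc _ ∎
    where open ≡-Reasoning

  lookup-multiplicities : ∀ {k} (t : Vec (Fin n) k) j → lookup (multiplicities t) j ≡ occ j t
  lookup-multiplicities t = lookup∘tabulate (λ j → occ j t)

expand : ∀ {n} (m : Vec ℕ n) → Vec (Fin n) (total m)
expand []      = []
expand (x ∷ m) = Vec.replicate x zero Vec.++ Vec.map suc (expand m)

occ-expand : ∀ {n} (m : Vec ℕ n) j → occ j (expand m) ≡ lookup m j
occ-expand (x ∷ m) j = trans (occ-++ j (Vec.replicate x zero) (Vec.map suc (expand m))) (split j)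
  where
  occ-replicate : ∀ j r → occ j (Vec.replicate r zero) ≡ r * 𝟙 (does (zero ≟ᶠ j))
  occ-replicate j zero    = refl
  occ-replicate j (suc r) = cong (𝟙 (does (zero ≟ᶠ j)) +_) (occ-replicate j r)
  occ-map-suc : ∀ {k} j (v : Vec (Fin _) k) → occ (suc j) (Vec.map suc v) ≡ occ j v
  occ-map-suc j []      = refl
  occ-map-suc j (y ∷ v) = cong (𝟙 (does (y ≟ᶠ j)) +_) (occ-map-suc j v)
  occ-map-suc-zero : ∀ {k} (v : Vec (Fin _) k) → occ zero (Vec.map suc v) ≡ 0
  occ-map-suc-zero []      = refl
  occ-map-suc-zero (y ∷ v) = occ-map-suc-zero v
  split : ∀ j → occ j (Vec.replicate x zero) + occ j (Vec.map suc (expand m)) ≡ lookup (x ∷ m) j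
  split zero    = trans (cong₂ _+_ (trans (occ-replicate zero x) (*-identityʳ x)) (occ-map-suc-zero (expand m)))
                        (+-identityʳ x)
  split (suc j) = cong₂ _+_ (trans (occ-replicate (suc j) x) (*-zeroʳ x)) (trans (occ-map-suc j (expand m)) (occ-expand m j))

Invariant : ∀ {n} → Permutation′ n → Vec ℕ n → Set
Invariant σ m = ∀ i → lookup m (σ ⟨$⟩ʳ i) ≡ lookup m i

invariant? : ∀ {n} (σ : Permutation′ n) (m : Vec ℕ n) → Dec (Invariant σ m)
invariant? σ m = all? (λ i → lookup m (σ ⟨$⟩ʳ i) ≟ lookup m i)

module _ {n : ℕ} where

  symPow-fixed⇔invariant : (σ : Permutation′ n) {k : ℕ} (t : Vec (Fin n) k) → Sorted t →
    symPow σ k t ≡ t ⇔ Invariant σ (multiplicities t)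
  symPow-fixed⇔invariant σ t sorted = mk⇔ fixed⇒invariant invariant⇒fixed
    where
    σt = Vec.map (σ ⟨$⟩ʳ_) t
    occ-symPow : ∀ j → occ j (sortV σt) ≡ occ (σ ⟨$⟩ˡ j) t
    occ-symPow j = trans (occ-sortV j σt) (occ-map σ j t)
    fixed⇒invariant : sortV σt ≡ t → Invariant σ (multiplicities t)
    fixed⇒invariant fixed i = begin
      lookup (multiplicities t) (σ ⟨$⟩ʳ i) ≡⟨ lookup-multiplicities t (σ ⟨$⟩ʳ i) ⟩
      occ (σ ⟨$⟩ʳ i) t                     ≡⟨ cong (occ (σ ⟨$⟩ʳ i)) fixed ⟨
      occ (σ ⟨$⟩ʳ i) (sortV σt)            ≡⟨ occ-symPow (σ ⟨$⟩ʳ i) ⟩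
      occ (σ ⟨$⟩ˡ (σ ⟨$⟩ʳ i)) t            ≡⟨ cong (λ j → occ j t) (inverseˡ σ) ⟩
      occ i t                              ≡⟨ lookup-multiplicities t i ⟨
      lookup (multiplicities t) i          ∎
      where open ≡-Reasoning
    invariant⇒fixed : Invariant σ (multiplicities t) → sortV σt ≡ t
    invariant⇒fixed inv = sorted-unique (sortV σt) t (sortV-sorted σt) sorted λ j → begin
      occ j (sortV σt)                     ≡⟨ occ-symPow j ⟩
      occ (σ ⟨$⟩ˡ j) t                     ≡⟨ lookup-multiplicities t (σ ⟨$⟩ˡ j) ⟨
      lookup (multiplicities t) (σ ⟨$⟩ˡ j) ≡⟨ inv (σ ⟨$⟩ˡ j) ⟨
      lookup (multiplicities t) (σ ⟨$⟩ʳ (σ ⟨$⟩ˡ j)) ≡⟨ cong (lookup (multiplicities t)) (inverseʳ σ) ⟩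
      lookup (multiplicities t) j          ≡⟨ lookup-multiplicities t j ⟩
      occ j t                              ∎
      where open ≡-Reasoning

  total-multiplicities : ∀ {k} (t : Vec (Fin n) k) → total (multiplicities t) ≡ k
  total-multiplicities t = trans (sum-cong-≗ {n} {lookup (multiplicities t)} (lookup-multiplicities t)) (∑-occ t)

  sorted-with-multiplicities⇔ : ∀ (m : Vec ℕ n) (t : Vec (Fin n) (total m)) →
    (Sorted t × multiplicities t ≡ m) ⇔ sortV (expand m) ≡ t
  sorted-with-multiplicities⇔ m t = mk⇔
    (λ (sorted , mult≡m) → sorted-unique t₀ t (sortV-sorted (expand m)) sorted λ j → begin
      occ j t₀                      ≡⟨ occ-t₀ j ⟩
      lookup m j                    ≡⟨ cong (λ v → lookup v j) mult≡m ⟨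
      lookup (multiplicities t) j   ≡⟨ lookup-multiplicities t j ⟩
      occ j t                       ∎)
    (λ { refl → sortV-sorted (expand m) ,
                lookup-ext (multiplicities t₀) m (λ j → trans (lookup-multiplicities t₀ j) (occ-t₀ j)) })
    where
    open ≡-Reasoning
    t₀ = sortV (expand m)
    occ-t₀ : ∀ j → occ j t₀ ≡ lookup m j
    occ-t₀ j = trans (occ-sortV j (expand m)) (occ-expand m j)

  ∑-sorted-with-multiplicities : ∀ k (m : Vec ℕ n) →
    ∑[ t ∈ allVecs (allFin n) k ] (𝟙 (weaklyIncreasing t) * 𝟙 (does (≡-dec _≟_ (multiplicities t) m)))
      ≡ 𝟙 (total m ≡ᵇ k)
  ∑-sorted-with-multiplicities k m with total m ≟ k
  ... | no total≢k = trans
    (∑ˡ-zero (allVecs (allFin n) k) λ t → trans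
      (cong (𝟙 (weaklyIncreasing t) *_) (𝟙-no (≡-dec _≟_ (multiplicities t) m)
         (λ mult≡m → total≢k (trans (cong total (sym mult≡m)) (total-multiplicities t)))))
      (*-zeroʳ (𝟙 (weaklyIncreasing t))))
    (sym (𝟙-no (total m ≟ k) total≢k))
  ... | yes refl = begin
    ∑[ t ∈ Ts ] (𝟙 (weaklyIncreasing t) * 𝟙 (does (≡-dec _≟_ (multiplicities t) m)))
      ≡⟨ ∑ˡ-cong Ts (λ t → sym (𝟙-∧ (weaklyIncreasing t) _)) ⟩
    ∑[ t ∈ Ts ] 𝟙 (does (T? (weaklyIncreasing t) ×-dec ≡-dec _≟_ (multiplicities t) m))
      ≡⟨ ∑ˡ-cong Ts (λ t → 𝟙-⇔ (T? (weaklyIncreasing t) ×-dec ≡-dec _≟_ (multiplicities t) m)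
                               (≡-dec _≟ᶠ_ t₀ t) (sorted-with-multiplicities⇔ m t)) ⟩
    ∑[ t ∈ Ts ] 𝟙 (does (≡-dec _≟ᶠ_ t₀ t))
      ≡⟨ allVecs-once _≟ᶠ_ (allFin n) t₀ (λ i → allFin-once n (lookup t₀ i)) ⟩
    1
      ≡⟨ 𝟙-yes (total m ≟ total m) refl ⟨
    𝟙 (total m ≡ᵇ total m) ∎
    where
    open ≡-Reasoning
    Ts = allVecs (allFin n) (total m)
    t₀ = sortV (expand m)

  ∑-sorted≡∑-multiplicities : ∀ k (Φ : Vec ℕ n → ℕ) →
    ∑[ t ∈ allVecs (allFin n) k ] (𝟙 (weaklyIncreasing t) * Φ (multiplicities t)) ≡
    ∑[ m ∈ allVecs (upTo (suc k)) n ] (𝟙 (total m ≡ᵇ k) * Φ m)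
  ∑-sorted≡∑-multiplicities k Φ = begin
    ∑[ t ∈ Ts ] F t
      ≡⟨ ∑ˡ-fibres (≡-dec _≟_) Ms multiplicities Ts F (λ t _ → allVecs-upTo-once k (multiplicities t)
           (λ j → subst (_≤ k) (sym (lookup-multiplicities t j)) (occ≤length j t))) ⟩
    ∑[ m ∈ Ms ] ∑[ t ∈ Ts ] (𝟙 (does (≡-dec _≟_ (multiplicities t) m)) * F t)
      ≡⟨ ∑ˡ-cong Ms fibre ⟩
    ∑[ m ∈ Ms ] (𝟙 (total m ≡ᵇ k) * Φ m) ∎
    where
    open ≡-Reasoning
    Ts = allVecs (allFin n) k
    Ms = allVecs (upTo (suc k)) n
    F : Vec (Fin n) k → ℕ
    F t = 𝟙 (weaklyIncreasing t) * Φ (multiplicities t)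
    fibre : ∀ m → ∑[ t ∈ Ts ] (𝟙 (does (≡-dec _≟_ (multiplicities t) m)) * F t) ≡ 𝟙 (total m ≡ᵇ k) * Φ m
    fibre m = begin
      ∑[ t ∈ Ts ] (is t * F t)
        ≡⟨ ∑ˡ-cong Ts (λ t → 𝟙-*-cong (≡-dec _≟_ (multiplicities t) m) (cong (λ v → 𝟙 (weaklyIncreasing t) * Φ v))) ⟩
      ∑[ t ∈ Ts ] (is t * (𝟙 (weaklyIncreasing t) * Φ m))
        ≡⟨ ∑ˡ-cong Ts (λ t → rearrange (is t) (𝟙 (weaklyIncreasing t)) (Φ m)) ⟩
      ∑[ t ∈ Ts ] (𝟙 (weaklyIncreasing t) * is t * Φ m)
        ≡⟨ *-distribʳ-∑ˡ (Φ m) Ts _ ⟨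
      ∑[ t ∈ Ts ] (𝟙 (weaklyIncreasing t) * is t) * Φ m
        ≡⟨ cong (_* Φ m) (∑-sorted-with-multiplicities k m) ⟩
      𝟙 (total m ≡ᵇ k) * Φ m ∎
      where
      is : Vec (Fin n) k → ℕ
      is t = 𝟙 (does (≡-dec _≟_ (multiplicities t) m))
      rearrange : ∀ a b c → a * (b * c) ≡ b * a * c
      rearrange = solve-∀

-- Cycles of a permutation

allBelow⇔ : ∀ m (p : ℕ → Bool) → T (allBelow m p) ⇔ (∀ j → j < m → T (p j))
allBelow⇔ m p = mk⇔ (to m) (from m)
  where
  to : ∀ m → T (allBelow m p) → ∀ j → j < m → T (p j)
  to (suc m) all j j<1+m with j ≟ m | Equivalence.to T-∧ all
  ... | yes refl | pm , _   = pm
  ... | no j≢m   | _  , all′ = to m all′ j (≤∧≢⇒< (≤-pred j<1+m) j≢m)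
  from : ∀ m → (∀ j → j < m → T (p j)) → T (allBelow m p)
  from zero    _   = _
  from (suc m) all = Equivalence.from T-∧ (all m ≤-refl , from m (λ j j<m → all j (m<n⇒m<1+n j<m)))

module Cycles {n : ℕ} (σ : Permutation′ n) where

  iter-+ : ∀ a b i → iter σ (a + b) i ≡ iter σ a (iter σ b i)
  iter-+ zero    b i = refl
  iter-+ (suc a) b i = cong (σ ⟨$⟩ʳ_) (iter-+ a b i)

  iter-comm : ∀ a b i → iter σ a (iter σ b i) ≡ iter σ b (iter σ a i)
  iter-comm a b i = trans (sym (iter-+ a b i)) (trans (cong (λ c → iter σ c i) (+-comm a b)) (iter-+ b a i))

  iter-injective : ∀ a {x y} → iter σ a x ≡ iter σ a y → x ≡ y
  iter-injective zero    e = e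
  iter-injective (suc a) e = iter-injective a (trans (sym (inverseˡ σ)) (trans (cong (σ ⟨$⟩ˡ_) e) (inverseˡ σ)))

  iter-∸-returns : ∀ i {a b} → a ≤ b → iter σ a i ≡ iter σ b i → iter σ (b ∸ a) i ≡ i
  iter-∸-returns i {a} {b} a≤b e = iter-injective a (begin
    iter σ a (iter σ (b ∸ a) i) ≡⟨ iter-comm a (b ∸ a) i ⟩
    iter σ (b ∸ a) (iter σ a i) ≡⟨ iter-+ (b ∸ a) a i ⟨
    iter σ (b ∸ a + a) i        ≡⟨ cong (λ c → iter σ c i) (m∸n+n≡m a≤b) ⟩
    iter σ b i                  ≡⟨ e ⟨
    iter σ a i                  ∎)
    where open ≡-Reasoning

  period-exists : ∀ i → ∃[ p ] (0 < p × p ≤ n × iter σ p i ≡ i)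
  period-exists i with pigeonhole (n<1+n n) (λ (j : Fin (suc n)) → iter σ (toℕ j) i)
  ... | a , b , a<b , e =
    toℕ b ∸ toℕ a , m<n⇒0<n∸m a<b , ≤-trans (m∸n≤m (toℕ b) (toℕ a)) (≤-pred (toℕ<n b)) ,
    iter-∸-returns i (<⇒≤ a<b) e

  record FirstReturn (i : Fin n) (m r : ℕ) : Set where
    field
      from     : m ≤ r
      returns  : iter σ r i ≡ i
      earliest : ∀ q → m ≤ q → q < r → iter σ q i ≢ i

  firstReturn-spec : ∀ i fuel m {p} → m ≤ p → p < m + fuel → iter σ p i ≡ i →
    firstReturn σ i m fuel ≤ p × FirstReturn i m (firstReturn σ i m fuel)
  firstReturn-spec i zero m m≤p p<m+0 _ = contradiction (subst (_ <_) (+-identityʳ m) p<m+0) (≤⇒≯ m≤p)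
  firstReturn-spec i (suc fuel) m {p} m≤p p<m+fuel ret with iter σ m i ≟ᶠ i
  ... | yes ret-m =
    m≤p , record { from = ≤-refl ; returns = ret-m ; earliest = λ q m≤q q<m → contradiction q<m (≤⇒≯ m≤q) }
  ... | no ¬ret-m with firstReturn-spec i fuel (suc m) m<p (subst (p <_) (+-suc m fuel) p<m+fuel) ret
    where
    m<p : m < p
    m<p = ≤∧≢⇒< m≤p (λ { refl → ¬ret-m ret })
  ...   | r≤p , fr =
    r≤p , record { from = <⇒≤ (FirstReturn.from fr) ; returns = FirstReturn.returns fr ; earliest = earliest }
    where
    earliest : ∀ q → m ≤ q → q < firstReturn σ i (suc m) fuel → iter σ q i ≢ i
    earliest q m≤q q<r with m ≟ q
    ... | yes refl = ¬ret-m
    ... | no m≢q   = FirstReturn.earliest fr q (≤∧≢⇒< m≤q m≢q) q<r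

  L : Fin n → ℕ
  L = cycleLen σ

  cycleLen-spec : ∀ i → L i ≤ n × FirstReturn i 1 (L i)
  cycleLen-spec i with period-exists i
  ... | p , 0<p , p≤n , ret with firstReturn-spec i n 1 0<p (s≤s p≤n) ret
  ...   | L≤p , fr = ≤-trans L≤p p≤n , fr

  0<cycleLen : ∀ i → 0 < L i
  0<cycleLen i = FirstReturn.from (proj₂ (cycleLen-spec i))

  cycleLen≤n : ∀ i → L i ≤ n
  cycleLen≤n i = proj₁ (cycleLen-spec i)

  iter-cycleLen : ∀ i → iter σ (L i) i ≡ i
  iter-cycleLen i = FirstReturn.returns (proj₂ (cycleLen-spec i))

  cycleLen-earliest : ∀ i q → 0 < q → q < L i → iter σ q i ≢ i
  cycleLen-earliest i = FirstReturn.earliest (proj₂ (cycleLen-spec i))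

  instance
    cycleLen-nonZero : ∀ {i} → NonZero (L i)
    cycleLen-nonZero {i} = >-nonZero (0<cycleLen i)

  iter-*-cycleLen : ∀ i q → iter σ (q * L i) i ≡ i
  iter-*-cycleLen i zero    = refl
  iter-*-cycleLen i (suc q) =
    trans (iter-+ (L i) (q * L i) i) (trans (cong (iter σ (L i)) (iter-*-cycleLen i q)) (iter-cycleLen i))

  iter-% : ∀ i j → iter σ j i ≡ iter σ (j % L i) i
  iter-% i j = begin
    iter σ j i                                  ≡⟨ cong (λ c → iter σ c i) (m≡m%n+[m/n]*n j (L i)) ⟩
    iter σ (j % L i + j / L i * L i) i          ≡⟨ iter-+ (j % L i) (j / L i * L i) i ⟩
    iter σ (j % L i) (iter σ (j / L i * L i) i) ≡⟨ cong (iter σ (j % L i)) (iter-*-cycleLen i (j / L i)) ⟩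
    iter σ (j % L i) i                          ∎
    where open ≡-Reasoning

  iter-distinct : ∀ i {a b} → a < L i → b < L i → iter σ a i ≡ iter σ b i → a ≡ b
  iter-distinct i {a} {b} a<L b<L e with <-cmp a b
  ... | tri≈ _ a≡b _ = a≡b
  ... | tri< a<b _ _ = contradiction (iter-∸-returns i (<⇒≤ a<b) e)
                         (cycleLen-earliest i (b ∸ a) (m<n⇒0<n∸m a<b) (≤-<-trans (m∸n≤m b a) b<L))
  ... | tri> _ _ b<a = contradiction (iter-∸-returns i (<⇒≤ b<a) (sym e))
                         (cycleLen-earliest i (a ∸ b) (m<n⇒0<n∸m b<a) (≤-<-trans (m∸n≤m a b) a<L))

  iter-reaches : ∀ i a b → ∃[ d ] iter σ d (iter σ a i) ≡ iter σ b i
  iter-reaches i a b = b + (a * L i ∸ a) , (begin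
    iter σ (b + (a * L i ∸ a)) (iter σ a i) ≡⟨ iter-+ (b + (a * L i ∸ a)) a i ⟨
    iter σ (b + (a * L i ∸ a) + a) i        ≡⟨ cong (λ c → iter σ c i) (trans (+-assoc b _ a)
                                                 (cong (b +_) (m∸n+n≡m (m≤m*n a (L i))))) ⟩
    iter σ (b + a * L i) i                  ≡⟨ iter-+ b (a * L i) i ⟩
    iter σ b (iter σ (a * L i) i)           ≡⟨ cong (iter σ b) (iter-*-cycleLen i a) ⟩
    iter σ b i                              ∎)
    where open ≡-Reasoning

  CycleMin : Fin n → Set
  CycleMin x = ∀ j → toℕ x ≤ toℕ (iter σ j x)

  isCycleMin⇔CycleMin : ∀ x → T (isCycleMin σ x) ⇔ CycleMin x
  isCycleMin⇔CycleMin x = mk⇔ to from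
    where
    below = allBelow⇔ (L x) (λ j → x ≤ᶠ iter σ j x)
    to : T (isCycleMin σ x) → CycleMin x
    to t j = subst (λ y → toℕ x ≤ toℕ y) (sym (iter-% x j))
      (≤ᵇ⇒≤ (toℕ x) _ (Equivalence.to below t (j % L x) (m%n<n j (L x))))
    from : CycleMin x → T (isCycleMin σ x)
    from c = Equivalence.from below (λ j _ → ≤⇒≤ᵇ (c j))

  cycleMins-equal : ∀ i a b → CycleMin (iter σ a i) → CycleMin (iter σ b i) → iter σ a i ≡ iter σ b i
  cycleMins-equal i a b min-a min-b with iter-reaches i a b | iter-reaches i b a
  ... | d , a→b | d′ , b→a = toℕ-injective (≤-antisym
    (subst (λ y → toℕ (iter σ a i) ≤ toℕ y) a→b (min-a d))
    (subst (λ y → toℕ (iter σ b i) ≤ toℕ y) b→a (min-b d′)))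

  cycleMin : Fin n → Fin n
  cycleMin i = argmin toℕ i (applyUpTo (λ j → iter σ j i) (L i))

  cycleMin-reached : ∀ i → ∃[ d ] iter σ d i ≡ cycleMin i
  cycleMin-reached i =
    argmin-all toℕ {P = λ x → ∃[ d ] iter σ d i ≡ x} (0 , refl) (applyUpTo⁺₂ _ (L i) (λ j → j , refl))

  cycleMin-minimal : ∀ i j → toℕ (cycleMin i) ≤ toℕ (iter σ j i)
  cycleMin-minimal i j = subst (λ y → toℕ (cycleMin i) ≤ toℕ y) (sym (iter-% i j))
    (applyUpTo⁻ (λ j → iter σ j i) (L i) (f[argmin]≤f[xs] {f = toℕ} i (applyUpTo (λ j → iter σ j i) (L i)))
                (m%n<n j (L i)))

  cycleMin-isCycleMin : ∀ i → CycleMin (cycleMin i)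
  cycleMin-isCycleMin i j with cycleMin-reached i
  ... | d , reach = subst (λ y → toℕ (cycleMin i) ≤ toℕ (iter σ j y)) reach
    (subst (λ y → toℕ (cycleMin i) ≤ toℕ y) (iter-+ j d i) (cycleMin-minimal i (j + d)))

  isCycleMin-cycleMin : ∀ i → T (isCycleMin σ (cycleMin i))
  isCycleMin-cycleMin i = Equivalence.from (isCycleMin⇔CycleMin (cycleMin i)) (cycleMin-isCycleMin i)

  cycleMin-iter : ∀ a i → cycleMin (iter σ a i) ≡ cycleMin i
  cycleMin-iter a i with cycleMin-reached (iter σ a i) | cycleMin-reached i
  ... | d′ , reach′ | d , reach = begin
    cycleMin (iter σ a i)      ≡⟨ reach′ ⟨
    iter σ d′ (iter σ a i)     ≡⟨ iter-+ d′ a i ⟨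
    iter σ (d′ + a) i          ≡⟨ cycleMins-equal i (d′ + a) d
                                    (subst CycleMin (trans (sym reach′) (sym (iter-+ d′ a i))) (cycleMin-isCycleMin (iter σ a i)))
                                    (subst CycleMin (sym reach) (cycleMin-isCycleMin i)) ⟩
    iter σ d i                 ≡⟨ reach ⟩
    cycleMin i                 ∎
    where open ≡-Reasoning

  cycleMin-fixed : ∀ i → CycleMin i → cycleMin i ≡ i
  cycleMin-fixed i min-i with cycleMin-reached i
  ... | d , reach = sym (trans (cycleMins-equal i 0 d min-i (subst CycleMin (sym reach) (cycleMin-isCycleMin i))) reach)

  -- i has cycle minimum r iff i = σ^j r for exactly one j < L r
  𝟙-cycleMin≡ : ∀ r → CycleMin r → ∀ i →
    𝟙 (does (cycleMin i ≟ᶠ r)) ≡ ∑< (L r) (λ j → 𝟙 (does (iter σ j r ≟ᶠ i)))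
  𝟙-cycleMin≡ r min-r i with cycleMin i ≟ᶠ r
  ... | no ¬i→r = sym (∑<-zero (L r) (λ j → 𝟙-no (iter σ j r ≟ᶠ i)
                    (λ { refl → ¬i→r (trans (cycleMin-iter j r) (cycleMin-fixed r min-r)) })))
  ... | yes refl with cycleMin-reached i
  ...   | d , reach with iter-reaches i d 0
  ...     | d′ , back = sym (trans (∑<-cong (L r) position) (∑<-indicator (L r) e (m%n<n d′ (L r))))
    where
    e = d′ % L r
    r→i : iter σ e r ≡ i
    r→i = trans (sym (iter-% r d′)) (trans (cong (iter σ d′) (sym reach)) back)
    position : ∀ j → j < L r → 𝟙 (does (iter σ j r ≟ᶠ i)) ≡ 𝟙 (e ≡ᵇ j)
    position j j<L = 𝟙-⇔ (iter σ j r ≟ᶠ i) (e ≟ j) $ mk⇔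
      (λ j→i → iter-distinct r (m%n<n d′ (L r)) j<L (trans r→i (sym j→i)))
      (λ { refl → r→i })

  cycleMin-fibre : ∀ r → ∑[ i ∈ allFin n ] 𝟙 (does (cycleMin i ≟ᶠ r)) ≡ 𝟙 (isCycleMin σ r) * L r
  cycleMin-fibre r with T? (isCycleMin σ r)
  ... | no ¬min-r = trans
    (∑ˡ-zero (allFin n) (λ i → 𝟙-no (cycleMin i ≟ᶠ r) (λ { refl → ¬min-r (isCycleMin-cycleMin i) })))
    (sym (𝟙-*-no (T? (isCycleMin σ r)) ¬min-r (L r)))
  ... | yes min-r = begin
    ∑[ i ∈ allFin n ] 𝟙 (does (cycleMin i ≟ᶠ r))
      ≡⟨ ∑ˡ-cong (allFin n) (𝟙-cycleMin≡ r (Equivalence.to (isCycleMin⇔CycleMin r) min-r)) ⟩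
    ∑[ i ∈ allFin n ] ∑< (L r) (λ j → 𝟙 (does (iter σ j r ≟ᶠ i)))
      ≡⟨ ∑ˡ-cong (allFin n) (λ i → ∑ˡ-upTo (L r) _) ⟨
    ∑[ i ∈ allFin n ] ∑[ j ∈ upTo (L r) ] 𝟙 (does (iter σ j r ≟ᶠ i))
      ≡⟨ ∑ˡ-comm (allFin n) (upTo (L r)) _ ⟩
    ∑[ j ∈ upTo (L r) ] ∑[ i ∈ allFin n ] 𝟙 (does (iter σ j r ≟ᶠ i))
      ≡⟨ ∑ˡ-cong (upTo (L r)) (λ j → allFin-once n (iter σ j r)) ⟩
    ∑[ j ∈ upTo (L r) ] 1
      ≡⟨ ∑ˡ-1≡length (upTo (L r)) ⟩
    length (upTo (L r))
      ≡⟨ length-upTo (L r) ⟩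
    L r
      ≡⟨ 𝟙-*-yes (T? (isCycleMin σ r)) min-r (L r) ⟨
    𝟙 (isCycleMin σ r) * L r ∎
    where open ≡-Reasoning

  ∑-cycleMin : ∀ (g : Fin n → ℕ) → ∑[ i < n ] g (cycleMin i) ≡ ∑[ r < n ] (𝟙 (isCycleMin σ r) * L r * g r)
  ∑-cycleMin g = begin
    ∑[ i < n ] g (cycleMin i)
      ≡⟨ ∑ˡ-allFin n _ ⟨
    ∑[ i ∈ allFin n ] g (cycleMin i)
      ≡⟨ ∑ˡ-fibres _≟ᶠ_ (allFin n) cycleMin (allFin n) (g ∘ cycleMin) (λ i _ → allFin-once n (cycleMin i)) ⟩
    ∑[ r ∈ allFin n ] ∑[ i ∈ allFin n ] (𝟙 (does (cycleMin i ≟ᶠ r)) * g (cycleMin i))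
      ≡⟨ ∑ˡ-cong (allFin n) fibre ⟩
    ∑[ r ∈ allFin n ] (𝟙 (isCycleMin σ r) * L r * g r)
      ≡⟨ ∑ˡ-allFin n _ ⟩
    ∑[ r < n ] (𝟙 (isCycleMin σ r) * L r * g r) ∎
    where
    open ≡-Reasoning
    fibre : ∀ r → ∑[ i ∈ allFin n ] (𝟙 (does (cycleMin i ≟ᶠ r)) * g (cycleMin i)) ≡ 𝟙 (isCycleMin σ r) * L r * g r
    fibre r = begin
      ∑[ i ∈ allFin n ] (𝟙 (does (cycleMin i ≟ᶠ r)) * g (cycleMin i))
        ≡⟨ ∑ˡ-cong (allFin n) (λ i → 𝟙-*-cong (cycleMin i ≟ᶠ r) (cong g)) ⟩
      ∑[ i ∈ allFin n ] (𝟙 (does (cycleMin i ≟ᶠ r)) * g r)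
        ≡⟨ *-distribʳ-∑ˡ (g r) (allFin n) _ ⟨
      ∑[ i ∈ allFin n ] 𝟙 (does (cycleMin i ≟ᶠ r)) * g r
        ≡⟨ cong (_* g r) (cycleMin-fibre r) ⟩
      𝟙 (isCycleMin σ r) * L r * g r ∎

  cycleType≡multiplicity : ∀ ℓ → cycleType σ ℓ ≡ multiplicity L (isCycleMin σ) ℓ
  cycleType≡multiplicity ℓ = trans (count≡∑ˡ (λ i → (L i ≡ᵇ ℓ) ∧ isCycleMin σ i) (allFin n)) (∑ˡ-allFin n _)

module _ {n : ℕ} (σ : Permutation′ n) where
  open Cycles σ

  VanishesOffCycleMins : Vec ℕ n → Set
  VanishesOffCycleMins h = ∀ i → T (isCycleMin σ i) ⊎ lookup h i ≡ 0

  vanishesOffCycleMins? : ∀ h → Dec (VanishesOffCycleMins h)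
  vanishesOffCycleMins? h = all? (λ i → T? (isCycleMin σ i) ⊎-dec (lookup h i ≟ 0))

  restrict : Vec ℕ n → Vec ℕ n
  restrict m = Vec.tabulate (λ i → 𝟙 (isCycleMin σ i) * lookup m i)

  extend : Vec ℕ n → Vec ℕ n
  extend h = Vec.tabulate (λ i → lookup h (cycleMin i))

  lookup-restrict : ∀ m i → lookup (restrict m) i ≡ 𝟙 (isCycleMin σ i) * lookup m i
  lookup-restrict m = lookup∘tabulate _

  lookup-extend : ∀ h i → lookup (extend h) i ≡ lookup h (cycleMin i)
  lookup-extend h = lookup∘tabulate _

  invariant-iter : ∀ m → Invariant σ m → ∀ j i → lookup m (iter σ j i) ≡ lookup m i
  invariant-iter m inv zero    i = refl
  invariant-iter m inv (suc j) i = trans (inv (iter σ j i)) (invariant-iter m inv j i)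

  restrict-vanishes : ∀ m → VanishesOffCycleMins (restrict m)
  restrict-vanishes m i with T? (isCycleMin σ i)
  ... | yes min-i = inj₁ min-i
  ... | no ¬min-i = inj₂ (trans (lookup-restrict m i) (𝟙-*-no (T? (isCycleMin σ i)) ¬min-i (lookup m i)))

  extend-restrict : ∀ m → Invariant σ m → extend (restrict m) ≡ m
  extend-restrict m inv = lookup-ext (extend (restrict m)) m λ i → let d , reach = cycleMin-reached i in begin
    lookup (extend (restrict m)) i   ≡⟨ lookup-extend (restrict m) i ⟩
    lookup (restrict m) (cycleMin i) ≡⟨ lookup-restrict m (cycleMin i) ⟩
    _                                ≡⟨ 𝟙-*-yes (T? (isCycleMin σ (cycleMin i))) (isCycleMin-cycleMin i) _ ⟩
    lookup m (cycleMin i)            ≡⟨ cong (lookup m) reach ⟨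
    lookup m (iter σ d i)            ≡⟨ invariant-iter m inv d i ⟩
    lookup m i                       ∎
    where open ≡-Reasoning

  restrict-extend : ∀ h → VanishesOffCycleMins h → restrict (extend h) ≡ h
  restrict-extend h vanishes = lookup-ext (restrict (extend h)) h restricted
    where
    restricted : ∀ i → lookup (restrict (extend h)) i ≡ lookup h i
    restricted i with T? (isCycleMin σ i) | vanishes i
    ... | yes min-i | _ = begin
      lookup (restrict (extend h)) i ≡⟨ lookup-restrict (extend h) i ⟩
      _                              ≡⟨ 𝟙-*-yes (T? (isCycleMin σ i)) min-i _ ⟩
      lookup (extend h) i            ≡⟨ lookup-extend h i ⟩
      lookup h (cycleMin i)          ≡⟨ cong (lookup h) (cycleMin-fixed i (Equivalence.to (isCycleMin⇔CycleMin i) min-i)) ⟩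
      lookup h i                     ∎
      where open ≡-Reasoning
    ... | no ¬min-i | inj₁ min-i = contradiction min-i ¬min-i
    ... | no ¬min-i | inj₂ hᵢ≡0  =
      trans (lookup-restrict (extend h) i) (trans (𝟙-*-no (T? (isCycleMin σ i)) ¬min-i _) (sym hᵢ≡0))

  extend-invariant : ∀ h → Invariant σ (extend h)
  extend-invariant h i =
    trans (lookup-extend h (σ ⟨$⟩ʳ i)) (trans (cong (lookup h) (cycleMin-iter 1 i)) (sym (lookup-extend h i)))

  restrict⇔extend : ∀ m h → (restrict m ≡ h × Invariant σ m) ⇔ (VanishesOffCycleMins h × extend h ≡ m)
  restrict⇔extend m h = mk⇔
    (λ { (refl , inv) → restrict-vanishes m , extend-restrict m inv })
    (λ { (vanishes , refl) → restrict-extend h vanishes , extend-invariant h })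

  restrict≤ : ∀ m i → lookup (restrict m) i ≤ lookup m i
  restrict≤ m i = subst (_≤ lookup m i) (sym (lookup-restrict m i))
    (subst (𝟙 (isCycleMin σ i) * lookup m i ≤_) (*-identityˡ (lookup m i))
           (*-monoˡ-≤ (lookup m i) (𝟙≤1 (isCycleMin σ i))))

  total-extend : ∀ h → VanishesOffCycleMins h → total (extend h) ≡ ∑[ i < n ] (L i * lookup h i)
  total-extend h vanishes = begin
    ∑[ i < n ] lookup (extend h) i                     ≡⟨ sum-cong-≗ {n} {lookup (extend h)} (lookup-extend h) ⟩
    ∑[ i < n ] lookup h (cycleMin i)                   ≡⟨ ∑-cycleMin (lookup h) ⟩
    ∑[ r < n ] (𝟙 (isCycleMin σ r) * L r * lookup h r) ≡⟨ sum-cong-≗ {n} {λ r → 𝟙 (isCycleMin σ r) * L r * lookup h r}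
                                                                         weight ⟩
    ∑[ r < n ] (L r * lookup h r)                      ∎
    where
    open ≡-Reasoning
    weight : ∀ r → 𝟙 (isCycleMin σ r) * L r * lookup h r ≡ L r * lookup h r
    weight r with vanishes r
    ... | inj₁ min-r = cong (_* lookup h r) (𝟙-*-yes (T? (isCycleMin σ r)) min-r (L r))
    ... | inj₂ hᵣ≡0  rewrite hᵣ≡0 = trans (*-zeroʳ (𝟙 (isCycleMin σ r) * L r)) (sym (*-zeroʳ (L r)))

  restrict-fibre : ∀ k h →
    ∑[ m ∈ allVecs (upTo (suc k)) n ]
      (𝟙 (does (≡-dec _≟_ (restrict m) h)) * (𝟙 (total m ≡ᵇ k) * 𝟙 (does (invariant? σ m)))) ≡
    𝟙 (∑[ i < n ] (L i * lookup h i) ≡ᵇ k) * 𝟙 (does (vanishesOffCycleMins? h))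
  restrict-fibre k h = begin
    ∑[ m ∈ Ms ] (𝟙 (does (≡-dec _≟_ (restrict m) h)) * (𝟙 (total m ≡ᵇ k) * 𝟙 (does (invariant? σ m))))
      ≡⟨ ∑ˡ-cong Ms (λ m → trans (x*[y*z]≡y*[x*z] (𝟙 (does (≡-dec _≟_ (restrict m) h))) (𝟙 (total m ≡ᵇ k)) _)
                                 (cong (𝟙 (total m ≡ᵇ k) *_) (bijection m))) ⟩
    ∑[ m ∈ Ms ] (𝟙 (total m ≡ᵇ k) * (V * 𝟙 (does (≡-dec _≟_ (extend h) m))))
      ≡⟨ ∑ˡ-cong Ms (λ m → x*[y*z]≡y*[z*x] (𝟙 (total m ≡ᵇ k)) V _) ⟩
    ∑[ m ∈ Ms ] (V * (𝟙 (does (≡-dec _≟_ (extend h) m)) * 𝟙 (total m ≡ᵇ k)))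
      ≡⟨ *-distribˡ-∑ˡ V Ms _ ⟨
    V * ∑[ m ∈ Ms ] (𝟙 (does (≡-dec _≟_ (extend h) m)) * 𝟙 (total m ≡ᵇ k))
      ≡⟨ cong (V *_) (∑ˡ-select (≡-dec _≟_) Ms (extend h) (λ m → 𝟙 (total m ≡ᵇ k)) extend-once) ⟩
    V * 𝟙 (total (extend h) ≡ᵇ k)
      ≡⟨ 𝟙-*-cong (vanishesOffCycleMins? h) (λ v → cong (λ t → 𝟙 (t ≡ᵇ k)) (total-extend h v)) ⟩
    V * 𝟙 (∑[ i < n ] (L i * lookup h i) ≡ᵇ k)
      ≡⟨ *-comm V (𝟙 (∑[ i < n ] (L i * lookup h i) ≡ᵇ k)) ⟩
    𝟙 (∑[ i < n ] (L i * lookup h i) ≡ᵇ k) * V ∎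
    where
    open ≡-Reasoning
    Ms = allVecs (upTo (suc k)) n
    V = 𝟙 (does (vanishesOffCycleMins? h))
    x*[y*z]≡y*[x*z] : ∀ a b c → a * (b * c) ≡ b * (a * c)
    x*[y*z]≡y*[x*z] = solve-∀
    x*[y*z]≡y*[z*x] : ∀ a b c → a * (b * c) ≡ b * (c * a)
    x*[y*z]≡y*[z*x] = solve-∀
    bijection : ∀ m → 𝟙 (does (≡-dec _≟_ (restrict m) h)) * 𝟙 (does (invariant? σ m)) ≡
                      V * 𝟙 (does (≡-dec _≟_ (extend h) m))
    bijection m = 𝟙-×-⇔ (≡-dec _≟_ (restrict m) h) (invariant? σ m)
                        (vanishesOffCycleMins? h) (≡-dec _≟_ (extend h) m) (restrict⇔extend m h)
    extend-once : 𝟙 (total (extend h) ≡ᵇ k) ≢ 0 → OccursOnce (≡-dec _≟_) Ms (extend h)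
    extend-once 𝟙≢0 with total (extend h) ≟ k
    ... | yes refl = allVecs-upTo-once k (extend h) (lookup≤total (extend h))
    ... | no ne    = contradiction (𝟙-no (total (extend h) ≟ k) ne) 𝟙≢0

  ∑-invariant≡∑-onCycleMins : ∀ k →
    ∑[ m ∈ allVecs (upTo (suc k)) n ] (𝟙 (total m ≡ᵇ k) * 𝟙 (does (invariant? σ m))) ≡
    ∑[ h ∈ allVecs (upTo (suc k)) n ] (𝟙 (∑[ i < n ] (L i * lookup h i) ≡ᵇ k) * 𝟙 (does (vanishesOffCycleMins? h)))
  ∑-invariant≡∑-onCycleMins k =
    trans (∑ˡ-fibres (≡-dec _≟_) Ms restrict Ms F restrict-once) (∑ˡ-cong Ms (restrict-fibre k))
    where
    Ms = allVecs (upTo (suc k)) n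
    F : Vec ℕ n → ℕ
    F m = 𝟙 (total m ≡ᵇ k) * 𝟙 (does (invariant? σ m))
    restrict-once : ∀ m → F m ≢ 0 → OccursOnce (≡-dec _≟_) Ms (restrict m)
    restrict-once m F≢0 with total m ≟ k
    ... | yes refl      = allVecs-upTo-once k (restrict m) (λ i → ≤-trans (restrict≤ m i) (lookup≤total m i))
    ... | no total≢k    = contradiction (𝟙-*-no (total m ≟ k) total≢k _) F≢0

  ∑-onCycleMins≡dilatedProd : ∀ k →
    ∑[ h ∈ allVecs (upTo (suc k)) n ] (𝟙 (∑[ i < n ] (L i * lookup h i) ≡ᵇ k) * 𝟙 (does (vanishesOffCycleMins? h))) ≡
    dilatedProd L (λ i s → 𝟙 (isCycleMin σ i ∨ (s ≡ᵇ 0))) k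
  ∑-onCycleMins≡dilatedProd k = trans
    (∑ˡ-cong (allVecs (upTo (suc k)) n) (λ h → cong (𝟙 (∑[ i < n ] (L i * lookup h i) ≡ᵇ k) *_)
                                                   (𝟙-all? (λ i → T? (isCycleMin σ i) ⊎-dec (lookup h i ≟ 0)))))
    (coeff-dilatedProd L 0<cycleLen (λ i s → 𝟙 (isCycleMin σ i ∨ (s ≡ᵇ 0))) ≤-refl)

Fix-symPow≡∑-invariant : ∀ {n} (σ : Permutation′ n) k →
  Fix-symPow σ k ≡ ∑[ m ∈ allVecs (upTo (suc k)) n ] (𝟙 (total m ≡ᵇ k) * 𝟙 (does (invariant? σ m)))
Fix-symPow≡∑-invariant {n} σ k = begin
  Fix-symPow σ k
    ≡⟨ count≡∑ˡ fixed (𝒞 n k) ⟩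
  ∑[ t ∈ 𝒞 n k ] 𝟙 (fixed t)
    ≡⟨ ∑ˡ-filter weaklyIncreasing Ts (𝟙 ∘ fixed) ⟩
  ∑[ t ∈ Ts ] (𝟙 (weaklyIncreasing t) * 𝟙 (fixed t))
    ≡⟨ ∑ˡ-cong Ts (λ t → 𝟙-*-cong (T? (weaklyIncreasing t)) (fixed⇔invariant t)) ⟩
  ∑[ t ∈ Ts ] (𝟙 (weaklyIncreasing t) * 𝟙 (does (invariant? σ (multiplicities t))))
    ≡⟨ ∑-sorted≡∑-multiplicities k (λ m → 𝟙 (does (invariant? σ m))) ⟩
  ∑[ m ∈ allVecs (upTo (suc k)) n ] (𝟙 (total m ≡ᵇ k) * 𝟙 (does (invariant? σ m))) ∎
  where
  open ≡-Reasoning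
  Ts = allVecs (allFin n) k
  fixed : Vec (Fin n) k → Bool
  fixed t = isYes (≡-dec _≟ᶠ_ (symPow σ k t) t)
  fixed⇔invariant : ∀ t → Sorted t → 𝟙 (fixed t) ≡ 𝟙 (does (invariant? σ (multiplicities t)))
  fixed⇔invariant t sorted = trans (cong 𝟙 (isYes≗does (≡-dec _≟ᶠ_ (symPow σ k t) t)))
    (𝟙-⇔ (≡-dec _≟ᶠ_ (symPow σ k t) t) (invariant? σ (multiplicities t)) (symPow-fixed⇔invariant σ t sorted))

theorem3p6 : (n k : ℕ) → 1 ≤ n → 1 ≤ k → (σ : Permutation′ n) →
    Fix-symPow σ k ≡ rhs n k (cycleType σ)
theorem3p6 n k _ _ σ = begin
  Fix-symPow σ k
    ≡⟨ Fix-symPow≡∑-invariant σ k ⟩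
  ∑[ m ∈ Ms ] (𝟙 (total m ≡ᵇ k) * 𝟙 (does (invariant? σ m)))
    ≡⟨ ∑-invariant≡∑-onCycleMins σ k ⟩
  ∑[ h ∈ Ms ] (𝟙 (∑[ i < n ] (L i * lookup h i) ≡ᵇ k) * 𝟙 (does (vanishesOffCycleMins? σ h)))
    ≡⟨ ∑-onCycleMins≡dilatedProd σ k ⟩
  dilatedProd L (λ i s → 𝟙 (isCycleMin σ i ∨ (s ≡ᵇ 0))) k
    ≡⟨ geometricProd≡binomialProd n L (isCycleMin σ) (λ i → 0<cycleLen i , cycleLen≤n i) k ⟩
  binomialProd n (multiplicity L (isCycleMin σ)) k
    ≡⟨ binomialProd-cong n cycleType≡multiplicity k ⟨
  binomialProd n (cycleType σ) k
    ≡⟨ rhs≡binomialProd n k (cycleType σ) ⟨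
  rhs n k (cycleType σ) ∎
  where
  open ≡-Reasoning
  open Cycles σ using (L; 0<cycleLen; cycleLen≤n; cycleType≡multiplicity)
  Ms = allVecs (upTo (suc k)) n
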